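{- Let $n \ge 1$ and let $T$ be a tree on $n$ vertices whose weighted Szeged index is minimum among all trees on $n$ vertices. Then no vertex of $T$ of degree $3$ is incident to two $3$-rays.
   Context: For a connected simple graph $G$ and an edge $e = uv \in E(G)$, let $n_u(e)$ denote the number of vertices $x \in V(G)$ with $d(x,u) < d(x,v)$, where $d$ is the shortest-path distance in $G$ (and similarly $n_v(e)$). The weighted Szeged index of $G$ is $$wSz(G) = \sum_{e = uv \in E(G)} \big(\deg(u) + \deg(v)\big)\, n_u(e)\, n_v(e),$$ where $\deg(u)$ is the degree of $u$. A leaf is a vertex of degree $1$. A vertex $r$ is incident to a $k$-ray if there is a path $r, r_1, r_2, \dots, r_k$ in the tree such that $r_1, \dots, r_{k-1}$ have degree $2$ and $r_k$ is a leaf; incident to two $3$-rays means there are two such paths of length $3$ starting at $r$ through distinct neighbours of $r$. -}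

module Defs where

open import Data.Nat using (ℕ; zero; suc; _+_; _*_; _≤_; _<ᵇ_)
open import Data.Fin using (Fin; toℕ; _≟_)
open import Data.List using (List; []; _∷_; _∷ʳ_; map; allFin; length; upTo)
open import Data.Nat.ListAction using (sum)
open import Data.Bool.ListAction using (any)
open import Data.List.Relation.Unary.Linked using (Linked)
open import Data.List.Relation.Unary.Unique.Propositional using (Unique)
open import Data.Bool using (Bool; true; false; _∧_; _∨_; if_then_else_; not)
open import Data.Product using (Σ; _×_; ∃)
open import Data.Empty using (⊥)
open import Relation.Nullary using (¬_; does)
open import Relation.Binary.PropositionalEquality using (_≡_; _≢_)

record SimpleGraph (n : ℕ) : Set where
  field
    adj    : Fin n → Fin n → Bool
    sym    : ∀ x y → adj x y ≡ adj y x
    irrefl : ∀ x → adj x x ≡ false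
open SimpleGraph public

module _ {n : ℕ} (G : SimpleGraph n) where

  Adj : Fin n → Fin n → Set
  Adj x y = adj G x y ≡ true

  countᵇ : (Fin n → Bool) → ℕ
  countᵇ p = sum (map (λ y → if p y then 1 else 0) (allFin n))

  degree : Fin n → ℕ
  degree x = countᵇ (adj G x)

  data Walk : Fin n → Fin n → ℕ → Set where
    here : ∀ {x} → Walk x x 0
    step : ∀ {x y z k} → Adj x y → Walk y z k → Walk x z (suc k)

  Connected : Set
  Connected = ∀ x y → ∃ λ k → Walk x y k

  HasCycle : Set
  HasCycle = Σ (Fin n) λ x → Σ (List (Fin n)) λ ys → Σ (Fin n) λ y →
    1 ≤ length ys × Linked Adj (x ∷ (ys ∷ʳ y)) × Unique (x ∷ (ys ∷ʳ y)) × Adj y x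

  IsTree : Set
  IsTree = Connected × ¬ HasCycle

  reachWithin : ℕ → Fin n → Fin n → Bool
  reachWithin zero x y = does (x ≟ y)
  reachWithin (suc k) x y =
    reachWithin k x y ∨ any (λ z → adj G x z ∧ reachWithin k z y) (allFin n)

  -- shortest-path distance: number of k < n for which no walk of length ≤ k
  -- exists.  For a connected graph on n vertices this is exactly d(x,y).
  dist : Fin n → Fin n → ℕ
  dist x y = sum (map (λ k → if reachWithin k x y then 0 else 1) (upTo n))

  nClose : Fin n → Fin n → ℕ
  nClose u v = countᵇ (λ x → dist x u <ᵇ dist x v)

  sumV : (Fin n → ℕ) → ℕ
  sumV f = sum (map f (allFin n))

  -- weighted Szeged index: each edge {u,v} counted once (toℕ u < toℕ v)
  wSz : ℕ
  wSz = sumV λ u → sumV λ v →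
    if adj G u v ∧ (toℕ u <ᵇ toℕ v)
    then (degree u + degree v) * nClose u v * nClose v u
    else 0

  record Ray3 (r : Fin n) : Set where
    field
      r₁ r₂ r₃ : Fin n
      adj₀₁ : Adj r r₁
      adj₁₂ : Adj r₁ r₂
      adj₂₃ : Adj r₂ r₃
      deg₁  : degree r₁ ≡ 2
      deg₂  : degree r₂ ≡ 2
      deg₃  : degree r₃ ≡ 1
      distinct : Unique (r ∷ r₁ ∷ r₂ ∷ r₃ ∷ [])

-- Let r have degree 3, neighbours a₁, b₁, c, and 3-rays r a₁ a₂ a₃ and r b₁ b₂ b₃.  Replacing the
-- edges a₂a₃ and b₂b₃ by ra₃ and a₃b₃ gives a tree T′ in which r carries three 2-rays.  In a tree,
-- n_u(uv) is the number of vertices on u's side of uv, and every edge away from the rays sees the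
-- rays through the edge rc only, so it contributes equally to wSz T and wSz T′.  With n = 8 + m and
-- d = deg c, the seven remaining edges contribute 288 + 52m + 7(3 + d)(1 + m) to wSz T and two less
-- to wSz T′, so T is not a minimum.

module Submission where

open import Defs hiding (sym)
open import Data.Nat using (ℕ; zero; suc; _+_; _*_; _≤_; _<_; _∸_; z≤n; s≤s; _<ᵇ_)
open import Data.Nat.Properties hiding (_≟_; ≡ᵇ⇒≡)
open import Data.Fin using (Fin; zero; suc; toℕ)
open import Data.Fin.Patterns using (0F; 1F; 2F; 3F; 4F; 5F; 6F; 7F)
open import Data.Fin.Properties using (_≟_; toℕ-injective) renaming (any? to ∃?; all? to ∀?)
open import Data.Bool using (Bool; true; false; _∧_; _∨_; if_then_else_; not) renaming (_≟_ to _≟ᵇ_)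
open import Data.Bool.Properties using (∧-conicalˡ; ∧-conicalʳ; ∧-comm; ∨-comm; ∨-identityʳ; ∨-zeroʳ; ∧-zeroʳ; not-involutive; ∨-conicalˡ; ∨-conicalʳ)
open import Data.Bool.ListAction using (any; all)
open import Data.List using (List; []; _∷_; _∷ʳ_; map; tabulate; allFin; length; applyUpTo)
open import Data.List.Properties using (length-map)
open import Data.Nat.ListAction using (sum)
open import Data.Nat.Tactic.RingSolver using (solve-∀)
open import Data.List.Membership.Propositional using (_∈_; _∉_)
open import Data.List.Membership.Propositional.Properties using (∈-allFin; ∈-map⁺; ∈-map⁻; ∈-++⁻; ∈-++⁺ʳ; ∈-++⁺ˡ)
open import Data.List.Relation.Unary.Any using (here; there; any?)
open import Data.List.Relation.Unary.All as All using (All; []; _∷_)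
open import Data.List.Relation.Unary.All.Properties using (¬Any⇒All¬)
open import Data.List.Relation.Unary.AllPairs using ([]; _∷_; allPairs?)
open import Data.List.Relation.Unary.Linked as Linked using (Linked; []; [-]; _∷_)
open import Data.List.Relation.Unary.Unique.Propositional using (Unique)
import Data.List.Relation.Unary.Unique.Propositional.Properties as UniqueP
open import Data.Product using (Σ; _×_; _,_; ∃; proj₁; proj₂)
open import Data.Sum using (_⊎_; inj₁; inj₂; [_,_]′)
open import Data.Empty using (⊥; ⊥-elim)
open import Function using (_∘_)
open import Relation.Nullary using (¬_; does; yes; no)
open import Relation.Nullary.Decidable using (dec-true; dec-false; True; toWitness; ¬?; _×-dec_)
open import Relation.Binary.PropositionalEquality
open import Algebra.Properties.CommutativeMonoid.Sum +-0-commutativeMonoid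
  using (∑-distrib-+; sum-cong-≗; sum-replicate-zero) renaming (sum to ∑)

private
  variable
    A : Set
    n : ℕ

∨-true : ∀ {a b : Bool} → (a ∨ b) ≡ true → a ≡ true ⊎ b ≡ true
∨-true {true}  _ = inj₁ refl
∨-true {false} e = inj₂ e

∧-true : ∀ {a b : Bool} → (a ∧ b) ≡ true → a ≡ true × b ≡ true
∧-true {a} {b} e = ∧-conicalˡ a b e , ∧-conicalʳ a b e

any-true⇒∃ : (p : A → Bool) (xs : List A) → any p xs ≡ true → ∃ λ z → z ∈ xs × p z ≡ true
any-true⇒∃ p (x ∷ xs) e with p x in px
... | true  = x , here refl , px
... | false = let (z , z∈xs , pz) = any-true⇒∃ p xs e in z , there z∈xs , pz

∃⇒any-true : (p : A → Bool) {xs : List A} {z : A} → z ∈ xs → p z ≡ true → any p xs ≡ true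
∃⇒any-true p (here refl) pz rewrite pz = refl
∃⇒any-true p {x ∷ _} (there z∈xs) pz rewrite ∃⇒any-true p z∈xs pz with p x
... | true  = refl
... | false = refl

all-true⇒ : (p : A → Bool) {xs : List A} {x : A} → all p xs ≡ true → x ∈ xs → p x ≡ true
all-true⇒ p {y ∷ _} e (here refl) = ∧-conicalˡ (p y) _ e
all-true⇒ p {y ∷ _} e (there x∈)  = all-true⇒ p (∧-conicalʳ (p y) _ e) x∈

any-false : (p : A → Bool) (xs : List A) → (∀ z → z ∈ xs → p z ≡ false) → any p xs ≡ false
any-false p []       _ = refl
any-false p (x ∷ xs) h rewrite h x (here refl) = any-false p xs (λ z z∈ → h z (there z∈))

any-cong : {p q : A → Bool} (xs : List A) → (∀ z → p z ≡ q z) → any p xs ≡ any q xs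
any-cong []       _   = refl
any-cong (x ∷ xs) p≗q = cong₂ _∨_ (p≗q x) (any-cong xs p≗q)

Bool-ext : ∀ {a b : Bool} → (a ≡ true → b ≡ true) → (b ≡ true → a ≡ true) → a ≡ b
Bool-ext {true}          a⇒b _ = sym (a⇒b refl)
Bool-ext {false} {false} _   _ = refl
Bool-ext {false} {true}  _ b⇒a = b⇒a refl

map-injective-on : ∀ {B : Set} {f : A → B} {xs} → Unique (map f xs) →
  ∀ {x y} → x ∈ xs → y ∈ xs → f x ≡ f y → x ≡ y
map-injective-on _ (here refl) (here refl) _ = refl
map-injective-on {f = f} (fx∉ ∷ _) (here refl) (there y∈) fx≡fy = ⊥-elim (All.lookup fx∉ (∈-map⁺ f y∈) fx≡fy)
map-injective-on {f = f} (fy∉ ∷ _) (there x∈) (here refl) fx≡fy = ⊥-elim (All.lookup fy∉ (∈-map⁺ f x∈) (sym fx≡fy))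
map-injective-on (_ ∷ uniq) (there x∈) (there y∈) fx≡fy = map-injective-on uniq x∈ y∈ fx≡fy

linked-map-All : ∀ {R R′ : A → A → Set} {P : A → Set} → (∀ {a b} → P a → R a b → R′ a b) →
  ∀ {xs} → All P xs → Linked R xs → Linked R′ xs
linked-map-All f _        []        = []
linked-map-All f _        [-]       = [-]
linked-map-All f (pa ∷ ps) (r ∷ rs) = f pa r ∷ linked-map-All f ps rs

no-two-distinct-in-[_] : ∀ (w : A) {p q} → p ∈ (w ∷ []) → q ∈ (w ∷ []) → p ≢ q → ⊥
no-two-distinct-in-[ w ] (here refl) (here refl) p≢q = p≢q refl

two-distinct-in-pair⇒second : ∀ {P : A → Set} {p q w₁ w₂} → p ∈ (w₁ ∷ w₂ ∷ []) → q ∈ (w₁ ∷ w₂ ∷ []) →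
  p ≢ q → P p → P q → P w₂
two-distinct-in-pair⇒second (here refl)         (here refl)         p≢q _  _  = ⊥-elim (p≢q refl)
two-distinct-in-pair⇒second (here refl)         (there (here refl)) _   _  Pq = Pq
two-distinct-in-pair⇒second (there (here refl)) _                   _   Pp _  = Pp

two-distinct-in-four⇒not-third : ∀ {P : A → Set} {p q w₁ w₂ w₃ w₄} →
  p ∈ (w₁ ∷ w₂ ∷ w₃ ∷ w₄ ∷ []) → q ∈ (w₁ ∷ w₂ ∷ w₃ ∷ w₄ ∷ []) → p ≢ q → P p → P q → P w₁ ⊎ P w₂ ⊎ P w₄
two-distinct-in-four⇒not-third (here refl)                         _ _ Pp _ = inj₁ Pp
two-distinct-in-four⇒not-third (there (here refl))                 _ _ Pp _ = inj₂ (inj₁ Pp)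
two-distinct-in-four⇒not-third (there (there (there (here refl))))  _ _ Pp _ = inj₂ (inj₂ Pp)
two-distinct-in-four⇒not-third (there (there (here refl))) (here refl)                        _ _ Pq = inj₁ Pq
two-distinct-in-four⇒not-third (there (there (here refl))) (there (here refl))                _ _ Pq = inj₂ (inj₁ Pq)
two-distinct-in-four⇒not-third (there (there (here refl))) (there (there (here refl)))        p≢q _ _ = ⊥-elim (p≢q refl)
two-distinct-in-four⇒not-third (there (there (here refl))) (there (there (there (here refl)))) _ _ Pq = inj₂ (inj₂ Pq)

_≡ᵇ_ : Fin n → Fin n → Bool
x ≡ᵇ y = does (x ≟ y)

≡ᵇ-refl : (x : Fin n) → (x ≡ᵇ x) ≡ true
≡ᵇ-refl x = dec-true (x ≟ x) refl

≢⇒≡ᵇ-false : {x y : Fin n} → x ≢ y → (x ≡ᵇ y) ≡ false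
≢⇒≡ᵇ-false {x = x} {y} = dec-false (x ≟ y)

≡ᵇ⇒≡ : {x y : Fin n} → (x ≡ᵇ y) ≡ true → x ≡ y
≡ᵇ⇒≡ {x = x} {y} e with x ≟ y
≡ᵇ⇒≡ e  | yes x≡y = x≡y
≡ᵇ⇒≡ () | no _

≡ᵇ-false⇒≢ : {x y : Fin n} → (x ≡ᵇ y) ≡ false → x ≢ y
≡ᵇ-false⇒≢ {x = x} e refl with () ← trans (sym e) (≡ᵇ-refl x)

_∈ᵇ_ : Fin n → List (Fin n) → Bool
x ∈ᵇ ps = any (x ≡ᵇ_) ps

∈ᵇ⇒∈ : {x : Fin n} {ps : List (Fin n)} → (x ∈ᵇ ps) ≡ true → x ∈ ps
∈ᵇ⇒∈ {x = x} {p ∷ ps} e with x ≟ p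
... | yes x≡p = here x≡p
... | no _    = there (∈ᵇ⇒∈ e)

∈⇒∈ᵇ : {x : Fin n} {ps : List (Fin n)} → x ∈ ps → (x ∈ᵇ ps) ≡ true
∈⇒∈ᵇ {x = x} (here refl) rewrite ≡ᵇ-refl x = refl
∈⇒∈ᵇ {x = x} {p ∷ _} (there x∈ps) rewrite ∈⇒∈ᵇ x∈ps with x ≡ᵇ p
... | true  = refl
... | false = refl

∉⇒∈ᵇ-false : {x : Fin n} {ps : List (Fin n)} → x ∉ ps → (x ∈ᵇ ps) ≡ false
∉⇒∈ᵇ-false {x = x} {ps} x∉ps with x ∈ᵇ ps in e
... | true  = ⊥-elim (x∉ps (∈ᵇ⇒∈ e))
... | false = refl

unique! : ∀ {k} (ls : List (Fin k)) → {True (allPairs? (λ x y → ¬? (x ≟ y)) ls)} → Unique ls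
unique! ls {p} = toWitness p

unique-lists! : ∀ {k} (N : Fin k → List (Fin k)) → {True (∀? (λ ℓ → allPairs? (λ x y → ¬? (x ≟ y)) (N ℓ)))} →
  ∀ ℓ → Unique (N ℓ)
unique-lists! N {p} = toWitness p

sum-map-tabulate : ∀ {m} (g : Fin m → A) (f : A → ℕ) → sum (map f (tabulate g)) ≡ ∑ (f ∘ g)
sum-map-tabulate {m = zero}  g f = refl
sum-map-tabulate {m = suc m} g f = cong (f (g zero) +_) (sum-map-tabulate (g ∘ suc) f)

sum-map-allFin : (f : Fin n → ℕ) → sum (map f (allFin n)) ≡ ∑ f
sum-map-allFin = sum-map-tabulate (λ x → x)

∑-mono-≤ : {f g : Fin n → ℕ} → (∀ x → f x ≤ g x) → ∑ f ≤ ∑ g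
∑-mono-≤ {n = zero}  f≤g = z≤n
∑-mono-≤ {n = suc n} f≤g = +-mono-≤ (f≤g zero) (∑-mono-≤ (f≤g ∘ suc))

∑-swap : (b : Fin n → Bool) (f g : Fin n → ℕ) → (∀ x → b x ≡ false → f x ≡ g x) →
  ∑ f + ∑ (λ x → if b x then g x else 0) ≡ ∑ g + ∑ (λ x → if b x then f x else 0)
∑-swap b f g f≗g = begin
    ∑ f + ∑ (λ x → if b x then g x else 0)  ≡⟨ ∑-distrib-+ f _ ⟨
    ∑ (λ x → f x + (if b x then g x else 0)) ≡⟨ sum-cong-≗ pointwise ⟩
    ∑ (λ x → g x + (if b x then f x else 0)) ≡⟨ ∑-distrib-+ g _ ⟩
    ∑ g + ∑ (λ x → if b x then f x else 0)  ∎
  where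
  open ≡-Reasoning
  pointwise : ∀ x → f x + (if b x then g x else 0) ≡ g x + (if b x then f x else 0)
  pointwise x with b x in bx
  ... | true  = +-comm (f x) (g x)
  ... | false = cong (_+ 0) (f≗g x bx)

∑-single : (z : Fin n) (h : Fin n → ℕ) → ∑ (λ y → if y ≡ᵇ z then h y else 0) ≡ h z
∑-single {n = suc n} zero    h = trans (cong (h zero +_) (sum-replicate-zero n)) (+-identityʳ _)
∑-single {n = suc n} (suc z) h = ∑-single z (h ∘ suc)

∑-restrict-unique : (ps : List (Fin n)) → Unique ps → (h : Fin n → ℕ) →
  ∑ (λ y → if y ∈ᵇ ps then h y else 0) ≡ sum (map h ps)
∑-restrict-unique {n} []       _            h = sum-replicate-zero n
∑-restrict-unique {n} (p ∷ ps) (p∉ps ∷ uniq) h = begin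
    ∑ (λ y → if (y ≡ᵇ p) ∨ (y ∈ᵇ ps) then h y else 0)
  ≡⟨ sum-cong-≗ split ⟩
    ∑ (λ y → (if y ≡ᵇ p then h y else 0) + (if y ∈ᵇ ps then h y else 0))
  ≡⟨ ∑-distrib-+ (λ y → if y ≡ᵇ p then h y else 0) _ ⟩
    ∑ (λ y → if y ≡ᵇ p then h y else 0) + ∑ (λ y → if y ∈ᵇ ps then h y else 0)
  ≡⟨ cong₂ _+_ (∑-single p h) (∑-restrict-unique ps uniq h) ⟩
    h p + sum (map h ps) ∎
  where
  open ≡-Reasoning
  p∉ : p ∉ ps
  p∉ p∈ps = All.lookup p∉ps p∈ps refl
  split : ∀ y → (if (y ≡ᵇ p) ∨ (y ∈ᵇ ps) then h y else 0)
              ≡ (if y ≡ᵇ p then h y else 0) + (if y ∈ᵇ ps then h y else 0)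
  split y with y ≟ p
  ... | yes refl rewrite ∉⇒∈ᵇ-false p∉ = sym (+-identityʳ _)
  ... | no _     = refl

count : (Fin n → Bool) → ℕ
count p = ∑ (λ y → if p y then 1 else 0)

countᵇ≡count : (G : SimpleGraph n) (p : Fin n → Bool) → countᵇ G p ≡ count p
countᵇ≡count G p = sum-map-allFin (λ y → if p y then 1 else 0)

count-cong : {p q : Fin n → Bool} → (∀ x → p x ≡ q x) → count p ≡ count q
count-cong p≗q = sum-cong-≗ (λ x → cong (λ b → if b then 1 else 0) (p≗q x))

count-mono : {p q : Fin n → Bool} → (∀ x → p x ≡ true → q x ≡ true) → count p ≤ count q
count-mono {p = p} {q} p⇒q = ∑-mono-≤ pointwise
  where
  pointwise : ∀ x → (if p x then 1 else 0) ≤ (if q x then 1 else 0)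
  pointwise x with p x in px
  ... | false = z≤n
  ... | true rewrite p⇒q x px = ≤-refl

count-∈ᵇ : (ps : List (Fin n)) → Unique ps → count (_∈ᵇ ps) ≡ length ps
count-∈ᵇ ps uniq = trans (∑-restrict-unique ps uniq (λ _ → 1)) (ones ps)
  where
  ones : ∀ (qs : List (Fin _)) → sum (map (λ _ → 1) qs) ≡ length qs
  ones []       = refl
  ones (_ ∷ qs) = cong suc (ones qs)

∑-ones : ∀ n → ∑ {n} (λ _ → 1) ≡ n
∑-ones zero    = refl
∑-ones (suc n) = cong suc (∑-ones n)

count-+-count-not : (p : Fin n → Bool) → count p + count (not ∘ p) ≡ n
count-+-count-not {n} p = trans (sym (∑-distrib-+ (λ x → if p x then 1 else 0) _)) (trans (sum-cong-≗ one) (∑-ones n))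
  where
  one : ∀ x → (if p x then 1 else 0) + (if not (p x) then 1 else 0) ≡ 1
  one x with p x
  ... | true  = refl
  ... | false = refl

length≤-unique : (ps : List (Fin n)) → Unique ps → length ps ≤ n
length≤-unique {n} ps uniq = begin
  length ps              ≡⟨ count-∈ᵇ ps uniq ⟨
  count (_∈ᵇ ps)         ≤⟨ count-mono {n = n} {q = λ _ → true} (λ _ _ → refl) ⟩
  count {n} (λ _ → true) ≡⟨ ∑-ones n ⟩
  n                      ∎
  where open ≤-Reasoning

-- Shortest-path distance

sumBelow : ℕ → (ℕ → ℕ) → ℕ
sumBelow zero    f = 0
sumBelow (suc m) f = f 0 + sumBelow m (f ∘ suc)

sum-map-applyUpTo : ∀ m (h f : ℕ → ℕ) → sum (map f (applyUpTo h m)) ≡ sumBelow m (f ∘ h)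
sum-map-applyUpTo zero    h f = refl
sum-map-applyUpTo (suc m) h f = cong (f (h 0) +_) (sum-map-applyUpTo m (h ∘ suc) f)

Upward : (ℕ → Bool) → Set
Upward g = ∀ k → g k ≡ true → g (suc k) ≡ true

upward-≤ : ∀ {g} → Upward g → ∀ {a b} → a ≤ b → g a ≡ true → g b ≡ true
upward-≤ {g} up {a} {b} a≤b ga = subst (λ t → g t ≡ true) (m+[n∸m]≡n a≤b) (go (b ∸ a))
  where
  go : ∀ c → g (a + c) ≡ true
  go zero    = subst (λ t → g t ≡ true) (sym (+-identityʳ a)) ga
  go (suc c) = subst (λ t → g t ≡ true) (sym (+-suc a c)) (up _ (go c))

sumBelow-threshold : ∀ m d (g : ℕ → Bool) → (∀ k → k < d → g k ≡ false) → (∀ k → d ≤ k → g k ≡ true) →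
  d ≤ m → sumBelow m (λ k → if g k then 0 else 1) ≡ d
sumBelow-threshold zero    .zero   g below above z≤n = refl
sumBelow-threshold (suc m) zero    g below above _ rewrite above 0 z≤n =
  sumBelow-threshold m zero (g ∘ suc) (λ _ ()) (λ k _ → above (suc k) z≤n) z≤n
sumBelow-threshold (suc m) (suc d) g below above (s≤s d≤m) rewrite below 0 (s≤s z≤n) =
  cong suc (sumBelow-threshold m d (g ∘ suc) (λ k k<d → below (suc k) (s≤s k<d))
                                             (λ k d≤k → above (suc k) (s≤s d≤k)) d≤m)

least-true : (g : ℕ → Bool) → Upward g → ∀ m → g m ≡ true →
  ∃ λ d → d ≤ m × g d ≡ true × (∀ k → k < d → g k ≡ false)
least-true g up zero    gm = zero , z≤n , gm , λ _ ()
least-true g up (suc m) gm with g m in gm′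
... | true  = let (d , d≤m , gd , below) = least-true g up m gm′ in d , m≤n⇒m≤1+n d≤m , gd , below
... | false = suc m , ≤-refl , gm , below
  where
  below : ∀ k → k < suc m → g k ≡ false
  below k (s≤s k≤m) with g k in gk
  ... | false = refl
  ... | true with () ← trans (sym (upward-≤ up k≤m gk)) gm′

module _ (G : SimpleGraph n) where

  adj-sym : ∀ {p q} → Adj G p q → Adj G q p
  adj-sym {p} {q} a = trans (SimpleGraph.sym G q p) a

  adj⇒≢ : ∀ {x y} → Adj G x y → x ≢ y
  adj⇒≢ {x} a refl with () ← trans (sym (SimpleGraph.irrefl G x)) a

  walk-++ : ∀ {x y z j k} → Walk G x y j → Walk G y z k → Walk G x z (j + k)
  walk-++ here       w = w
  walk-++ (step a v) w = step a (walk-++ v w)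

  walk⇒reachWithin : ∀ {x y j} → Walk G x y j → ∀ k → j ≤ k → reachWithin G k x y ≡ true
  walk⇒reachWithin {x} here zero z≤n = ≡ᵇ-refl x
  walk⇒reachWithin {x} here (suc k) _ rewrite walk⇒reachWithin {x} here k z≤n = refl
  walk⇒reachWithin {x} {y} (step {y = z} a w) (suc k) (s≤s j≤k)
    rewrite ∃⇒any-true (λ z → adj G x z ∧ reachWithin G k z y) (∈-allFin z)
              (subst (λ b → (b ∧ reachWithin G k z y) ≡ true) (sym a) (walk⇒reachWithin w k j≤k))
    with reachWithin G k x y
  ... | true  = refl
  ... | false = refl

  reachWithin⇒walk : ∀ k x y → reachWithin G k x y ≡ true → ∃ λ j → j ≤ k × Walk G x y j
  reachWithin⇒walk zero x y e rewrite ≡ᵇ⇒≡ {x = x} {y} e = 0 , z≤n , here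
  reachWithin⇒walk (suc k) x y e with ∨-true {reachWithin G k x y} e
  ... | inj₁ e′ = let (j , j≤k , w) = reachWithin⇒walk k x y e′ in j , m≤n⇒m≤1+n j≤k , w
  ... | inj₂ e′ with any-true⇒∃ _ (allFin n) e′
  ... | z , _ , e″ with ∧-true {adj G x z} e″
  ... | a , reach = let (j , j≤k , w) = reachWithin⇒walk k z y reach in suc j , s≤s j≤k , step a w

  reachWithin-upward : ∀ x y → Upward (λ k → reachWithin G k x y)
  reachWithin-upward x y k e rewrite e = refl

  vertices : ∀ {x y k} → Walk G x y k → List (Fin n)
  vertices {x} here       = x ∷ []
  vertices {x} (step _ w) = x ∷ vertices w

  length-vertices : ∀ {x y k} (w : Walk G x y k) → length (vertices w) ≡ suc k
  length-vertices here       = refl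
  length-vertices (step _ w) = cong suc (length-vertices w)

  walk-from-visited : ∀ {x z y k} (w : Walk G z y k) → x ∈ vertices w →
    ∃ λ j → j ≤ k × Σ (Walk G x y j) λ w′ → Unique (vertices w) → Unique (vertices w′)
  walk-from-visited here         (here refl) = 0 , z≤n , here , λ u → u
  walk-from-visited {k = k} (step a w) (here refl) = k , ≤-refl , step a w , λ u → u
  walk-from-visited (step _ w)   (there x∈w) =
    let (j , j≤k , w′ , f) = walk-from-visited w x∈w in j , m≤n⇒m≤1+n j≤k , w′ , λ { (_ ∷ u) → f u }

  walk⇒path : ∀ {x y k} (w : Walk G x y k) → ∃ λ j → j ≤ k × Σ (Walk G x y j) λ p → Unique (vertices p)
  walk⇒path here = 0 , z≤n , here , [] ∷ []
  walk⇒path {x} (step a w) with walk⇒path w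
  ... | j , j≤k , p , u with any? (x ≟_) (vertices p)
  ... | yes x∈p = let (j′ , j′≤j , p′ , f) = walk-from-visited p x∈p in j′ , m≤n⇒m≤1+n (≤-trans j′≤j j≤k) , p′ , f u
  ... | no  x∉p = suc j , s≤s j≤k , step a p , ¬Any⇒All¬ _ x∉p ∷ u

  walk⇒short-walk : ∀ {x y k} → Walk G x y k → ∃ λ j → j < n × Walk G x y j
  walk⇒short-walk w with walk⇒path w
  ... | j , _ , p , u = j , subst (_≤ n) (length-vertices p) (length≤-unique (vertices p) u) , p

  IsDistance : Fin n → Fin n → ℕ → Set
  IsDistance x y d = Walk G x y d × (∀ j → Walk G x y j → d ≤ j)

  dist-isDistance : ∀ x y {k} → Walk G x y k → IsDistance x y (dist G x y)
  dist-isDistance x y w with walk⇒short-walk w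
  ... | j , j<n , p with least-true (λ k → reachWithin G k x y) (reachWithin-upward x y) j (walk⇒reachWithin p j ≤-refl)
  ... | d , d≤j , reach-d , below = subst (IsDistance x y) (sym dist≡d) (shortest , minimal)
    where
    dist≡d : dist G x y ≡ d
    dist≡d = trans (sum-map-applyUpTo n (λ k → k) (λ k → if reachWithin G k x y then 0 else 1))
      (sumBelow-threshold n d (λ k → reachWithin G k x y) below
        (λ k d≤k → upward-≤ (reachWithin-upward x y) d≤k reach-d) (≤-trans d≤j (<⇒≤ j<n)))
    minimal : ∀ i → Walk G x y i → d ≤ i
    minimal i wi with d ≤? i
    ... | yes d≤i = d≤i
    ... | no  d≰i with () ← trans (sym (walk⇒reachWithin wi i ≤-refl)) (below i (≰⇒> d≰i))
    shortest : Walk G x y d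
    shortest with reachWithin⇒walk d x y reach-d
    ... | j′ , j′≤d , w′ with m≤n⇒m<n∨m≡n j′≤d
    ... | inj₂ refl = w′
    ... | inj₁ j′<d with () ← trans (sym (walk⇒reachWithin w′ j′ ≤-refl)) (below j′ j′<d)

  dist-unique : ∀ {x y d} → IsDistance x y d → dist G x y ≡ d
  dist-unique {x} {y} (w , minimal) =
    let (w′ , minimal′) = dist-isDistance x y w in ≤-antisym (minimal′ _ w) (minimal _ w′)

  dist-refl : ∀ x → dist G x x ≡ 0
  dist-refl x = dist-unique (here , λ _ _ → z≤n)

  dist-minimal : ∀ {x y k} → Walk G x y k → dist G x y ≤ k
  dist-minimal {x} {y} w = proj₂ (dist-isDistance x y w) _ w

  shortest-walk : Connected G → ∀ x y → Walk G x y (dist G x y)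
  shortest-walk conn x y = proj₁ (dist-isDistance x y (proj₂ (conn x y)))

-- Cut edges

<ᵇ-cancelˡ : ∀ a b c → (a + b <ᵇ a + c) ≡ (b <ᵇ c)
<ᵇ-cancelˡ zero    b c = refl
<ᵇ-cancelˡ (suc a) b c = <ᵇ-cancelˡ a b c

m<ᵇm+1 : ∀ m → (m <ᵇ m + 1) ≡ true
m<ᵇm+1 zero    = refl
m<ᵇm+1 (suc m) = m<ᵇm+1 m

m+1<ᵇm : ∀ m → (m + 1 <ᵇ m) ≡ false
m+1<ᵇm zero    = refl
m+1<ᵇm (suc m) = m+1<ᵇm m

module _ (G : SimpleGraph n) where

  Cut : (Fin n → Bool) → Fin n → Fin n → Set
  Cut A u v = ∀ p q → Adj G p q → A p ≡ true → A q ≡ false → p ≡ u × q ≡ v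

  cut-complement : ∀ {A u v} → Cut A u v → Cut (not ∘ A) v u
  cut-complement {A} cut p q a _ _ with A p in Ap | A q in Aq
  cut-complement {A} cut p q a refl refl | false | true =
    let (q≡u , p≡v) = cut q p (adj-sym G a) Aq Ap in p≡v , q≡u

  walk-across-cut : ∀ {A u v} → Cut A u v → ∀ {x y k} → Walk G x y k → A x ≡ true → A y ≡ false →
    ∃ λ i → ∃ λ j → Walk G x u i × Walk G v y j × suc (i + j) ≡ k
  walk-across-cut cut here Ax Ay with () ← trans (sym Ax) Ay
  walk-across-cut {A} cut {x} (step {y = z} {k = k} a w) Ax Ay with A z in Az
  ... | true  = let (i , j , wu , wv , e) = walk-across-cut cut w Az Ay in suc i , j , step a wu , wv , cong suc e
  ... | false with cut x z a Ax Az
  ... | refl , refl = 0 , k , here , w , refl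

  dist-across-cut : Connected G → ∀ {A u v} → Cut A u v → Adj G u v → ∀ {x y} → A x ≡ true → A y ≡ false →
    dist G x y ≡ dist G x u + suc (dist G v y)
  dist-across-cut conn {A} {u} {v} cut a {x} {y} Ax Ay = dist-unique G (through-uv , minimal)
    where
    through-uv : Walk G x y (dist G x u + suc (dist G v y))
    through-uv = walk-++ G (shortest-walk G conn x u) (step a (shortest-walk G conn v y))
    minimal : ∀ k → Walk G x y k → dist G x u + suc (dist G v y) ≤ k
    minimal k w with walk-across-cut cut w Ax Ay
    ... | i , j , wu , wv , refl =
      subst (_≤ suc (i + j)) (sym (+-suc _ _)) (s≤s (+-mono-≤ (dist-minimal G wu) (dist-minimal G wv)))

  nClose-cut : Connected G → ∀ {A u v} → Cut A u v → Adj G u v → A u ≡ true → A v ≡ false →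
    nClose G u v ≡ count A
  nClose-cut conn {A} {u} {v} cut a Au Av =
    trans (countᵇ≡count G (λ x → dist G x u <ᵇ dist G x v)) (count-cong closer⇔A)
    where
    closer⇔A : ∀ x → (dist G x u <ᵇ dist G x v) ≡ A x
    closer⇔A x with A x in Ax
    ... | true  = trans (cong (dist G x u <ᵇ_)
                           (trans (dist-across-cut conn cut a Ax Av) (cong (λ t → dist G x u + suc t) (dist-refl G v))))
                         (m<ᵇm+1 (dist G x u))
    ... | false = trans (cong (_<ᵇ dist G x v)
                           (trans (dist-across-cut conn (cut-complement cut) (adj-sym G a) (cong not Ax) (cong not Au))
                                  (cong (λ t → dist G x v + suc t) (dist-refl G u))))
                         (m+1<ᵇm (dist G x v))

-- An excursion into S leaves through the cut edge it entered by, so it can be cut out.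
walk-avoiding : (G H : SimpleGraph n) (S : Fin n → Bool) {r c : Fin n} → Cut G S r c →
  (∀ x y → S x ≡ false → S y ≡ false → adj G x y ≡ adj H x y) →
  ∀ {x y k} → Walk G x y k → S x ≡ false → S y ≡ false → ∃ λ j → j ≤ k × Walk H x y j
walk-avoiding G H S cut agree w = go _ ≤-refl w
  where
  go : ∀ b {x y k} → k ≤ b → Walk G x y k → S x ≡ false → S y ≡ false → ∃ λ j → j ≤ k × Walk H x y j
  go _       _         here Sx Sy = 0 , z≤n , here
  go (suc b) {x} (s≤s k≤b) (step {y = z} {k = k} a w) Sx Sy with S z in Sz
  ... | false = let (j , j≤k , w′) = go b k≤b w Sz Sy in suc j , s≤s j≤k , step (trans (sym (agree x z Sx Sz)) a) w′
  ... | true with cut z x (adj-sym G a) Sz Sx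
  ... | refl , refl with walk-across-cut G cut w Sz Sy
  ... | i , j , _ , w-rest , refl =
    let j≤k = ≤-trans (m≤n+m j i) (n≤1+n _)
        (j′ , j′≤j , w′) = go b (≤-trans j≤k k≤b) w-rest Sx Sy
    in j′ , ≤-trans j′≤j (≤-trans j≤k (n≤1+n _)) , w′

dist-≤-avoiding : (G H : SimpleGraph n) (S : Fin n → Bool) {r c : Fin n} → Cut G S r c →
  (∀ x y → S x ≡ false → S y ≡ false → adj G x y ≡ adj H x y) → Connected G →
  ∀ {x y} → S x ≡ false → S y ≡ false → dist H x y ≤ dist G x y
dist-≤-avoiding G H S cut agree conn {x} {y} Sx Sy =
  let (_ , j≤d , w) = walk-avoiding G H S cut agree (shortest-walk G conn x y) Sx Sy
  in ≤-trans (dist-minimal H w) j≤d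

module AgreeOutside (G H : SimpleGraph n) (S : Fin n → Bool) (r c : Fin n)
  (cutG : Cut G S r c) (cutH : Cut H S r c)
  (agree : ∀ x y → S x ≡ false → S y ≡ false → adj G x y ≡ adj H x y)
  (connG : Connected G) (connH : Connected H)
  (adjG : Adj G r c) (adjH : Adj H r c) (Sc : S c ≡ false) where

  dist-outside : ∀ x y → S x ≡ false → S y ≡ false → dist G x y ≡ dist H x y
  dist-outside x y Sx Sy = ≤-antisym
    (dist-≤-avoiding H G S cutH (λ x y Sx Sy → sym (agree x y Sx Sy)) connH Sx Sy)
    (dist-≤-avoiding G H S cutG agree connG Sx Sy)

  nClose-outside : ∀ u v → S u ≡ false → S v ≡ false → nClose G u v ≡ nClose H u v
  nClose-outside u v Su Sv =
    trans (countᵇ≡count G _) (trans (count-cong same-side) (sym (countᵇ≡count H _)))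
    where
    via-r : ∀ (K : SimpleGraph n) → Connected K → Cut K S r c → Adj K r c → ∀ {x} → S x ≡ true →
      (dist K x u <ᵇ dist K x v) ≡ (dist K c u <ᵇ dist K c v)
    via-r K conn cut a Sx = trans (cong₂ _<ᵇ_ (dist-across-cut K conn cut a Sx Su) (dist-across-cut K conn cut a Sx Sv))
                                  (<ᵇ-cancelˡ (dist K _ r) (suc (dist K c u)) (suc (dist K c v)))
    same-side : ∀ x → (dist G x u <ᵇ dist G x v) ≡ (dist H x u <ᵇ dist H x v)
    same-side x with S x in Sx
    ... | false = cong₂ _<ᵇ_ (dist-outside x u Sx Su) (dist-outside x v Sx Sv)
    ... | true  = trans (via-r G connG cutG adjG Sx)
                 (trans (cong₂ _<ᵇ_ (dist-outside c u Sc Su) (dist-outside c v Sc Sv))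
                        (sym (via-r H connH cutH adjH Sx)))

-- Degrees and cycles

module _ (G : SimpleGraph n) where

  degree≡count : ∀ p → degree G p ≡ count (adj G p)
  degree≡count p = countᵇ≡count G (adj G p)

  neighbour-listed : ∀ {p ws} → degree G p ≡ length ws → Unique ws → All (Adj G p) ws →
    ∀ {q} → Adj G p q → q ∈ ws
  neighbour-listed {p} {ws} deg uniq adjs {q} a with any? (q ≟_) ws
  ... | yes q∈ws = q∈ws
  ... | no  q∉ws = ⊥-elim (1+n≰n (begin
      suc (length ws)       ≡⟨ count-∈ᵇ (q ∷ ws) (¬Any⇒All¬ _ q∉ws ∷ uniq) ⟨
      count (_∈ᵇ (q ∷ ws))  ≤⟨ count-mono listed⇒adj ⟩
      count (adj G p)       ≡⟨ trans (sym (degree≡count p)) deg ⟩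
      length ws             ∎))
    where
    open ≤-Reasoning
    listed⇒adj : ∀ x → (x ∈ᵇ (q ∷ ws)) ≡ true → adj G p x ≡ true
    listed⇒adj x e with ∈ᵇ⇒∈ {x = x} {q ∷ ws} e
    ... | here refl = a
    ... | there x∈ws = All.lookup adjs x∈ws

  unlisted-neighbour : ∀ {p ws} → Unique ws → degree G p ≡ suc (length ws) → ∃ λ q → Adj G p q × q ∉ ws
  unlisted-neighbour {p} {ws} uniq deg with ∃? (λ q → (adj G p q ≟ᵇ true) ×-dec ¬? (any? (q ≟_) ws))
  ... | yes found = found
  ... | no  none  = ⊥-elim (1+n≰n (begin
      suc (length ws)  ≡⟨ trans (sym deg) (degree≡count p) ⟩
      count (adj G p)  ≤⟨ count-mono adj⇒listed ⟩
      count (_∈ᵇ ws)   ≡⟨ count-∈ᵇ ws uniq ⟩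
      length ws        ∎))
    where
    open ≤-Reasoning
    adj⇒listed : ∀ x → adj G p x ≡ true → (x ∈ᵇ ws) ≡ true
    adj⇒listed x a with any? (x ≟_) ws
    ... | yes x∈ws = ∈⇒∈ᵇ x∈ws
    ... | no  x∉ws = ⊥-elim (none (x , a , x∉ws))

TwoNeighboursIn : (R : A → A → Set) → List A → A → Set
TwoNeighboursIn R L z = ∃ λ p → ∃ λ q → p ∈ L × q ∈ L × p ≢ q × R z p × R z q

module _ {R : A → A → Set} (R-sym : ∀ {a b} → R a b → R b a) where

  private
    last-step : ∀ a w ws y → Linked R (a ∷ ((w ∷ ws) ∷ʳ y)) → ∃ λ p → p ∈ (w ∷ ws) × R p y
    last-step a w []        y (_ ∷ (r ∷ _)) = w , here refl , r
    last-step a w (w′ ∷ ws) y (_ ∷ rs)      = let (p , p∈ , r) = last-step w w′ ws y rs in p , there p∈ , r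

    first-step : ∀ w ws y → Linked R (w ∷ (ws ∷ʳ y)) → ∃ λ q → q ∈ (ws ∷ʳ y) × R w q
    first-step w []        y (r ∷ _) = y , here refl , r
    first-step w (w′ ∷ ws) y (r ∷ _) = w′ , here refl , r

    interior : ∀ a ws y z → Linked R (a ∷ (ws ∷ʳ y)) → Unique (a ∷ (ws ∷ʳ y)) → z ∈ ws →
      TwoNeighboursIn R (a ∷ (ws ∷ʳ y)) z
    interior a (w ∷ ws) y z rs (a∉ ∷ _) (here refl) =
      let (q , q∈ , r) = first-step w ws y (Linked.tail rs)
      in a , q , here refl , there (there q∈) , All.lookup a∉ (there q∈) , R-sym (Linked.head rs) , r
    interior a (w ∷ ws) y z rs (_ ∷ uniq) (there z∈) =
      let (p , q , p∈ , q∈ , p≢q , rp , rq) = interior w ws y z (Linked.tail rs) uniq z∈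
      in p , q , there p∈ , there q∈ , p≢q , rp , rq

  cycle-two-neighbours : ∀ x ys y z → 1 ≤ length ys → Linked R (x ∷ (ys ∷ʳ y)) → Unique (x ∷ (ys ∷ʳ y)) →
    R y x → z ∈ (x ∷ (ys ∷ʳ y)) → TwoNeighboursIn R (x ∷ (ys ∷ʳ y)) z
  cycle-two-neighbours x (h ∷ ys) y z _ rs (_ ∷ (h∉ ∷ _)) ryx (here refl) =
    h , y , there (here refl) , there (∈-++⁺ʳ (h ∷ ys) (here refl)) ,
    All.lookup h∉ (∈-++⁺ʳ ys (here refl)) , Linked.head rs , R-sym ryx
  cycle-two-neighbours x ys@(h ∷ ys′) y z _ rs uniq@(x∉ ∷ _) ryx (there z∈) with ∈-++⁻ ys z∈
  ... | inj₁ z∈ys = interior x ys y z rs uniq z∈ys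
  ... | inj₂ (here refl) =
    let (p , p∈ , r) = last-step x h ys′ y rs
    in x , p , here refl , there (∈-++⁺ˡ p∈) , All.lookup x∉ (∈-++⁺ˡ p∈) , ryx , R-sym r

module _ (G H : SimpleGraph n) (S : Fin n → Bool) (agree : ∀ x y → S x ≡ false → adj G x y ≡ adj H x y) where

  connected-transfer : Connected G → (∀ {x y} → S x ≡ true → Adj G x y → ∃ λ k → Walk H x y k) → Connected H
  connected-transfer conn bridge x y = go (proj₂ (conn x y))
    where
    go : ∀ {x y k} → Walk G x y k → ∃ λ k′ → Walk H x y k′
    go here = 0 , here
    go {x} (step {y = z} a w) with S x in Sx
    ... | false = let (k , w′) = go w in suc k , step (trans (sym (agree x z Sx)) a) w′
    ... | true  = let (k₁ , w₁) = bridge Sx a ; (k₂ , w₂) = go w in k₁ + k₂ , walk-++ H w₁ w₂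

  acyclic-transfer : ¬ HasCycle G →
    (∀ {x ys y} → 1 ≤ length ys → Linked (Adj H) (x ∷ (ys ∷ʳ y)) → Unique (x ∷ (ys ∷ʳ y)) → Adj H y x →
       All (λ z → S z ≡ false) (x ∷ (ys ∷ʳ y))) →
    ¬ HasCycle H
  acyclic-transfer acyclic avoids (x , ys , y , len , path , uniq , closing) =
    acyclic (x , ys , y , len , linked-map-All back outside path , uniq ,
             back (All.lookup outside (there (∈-++⁺ʳ ys (here refl)))) closing)
    where
    outside = avoids len path uniq closing
    back : ∀ {a b} → S a ≡ false → Adj H a b → Adj G a b
    back {a} {b} Sa a-b = trans (agree a b Sa) a-b

-- The weighted Szeged index as a sum of rows

module _ (G : SimpleGraph n) where

  edgeWeight : Fin n → Fin n → ℕ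
  edgeWeight u v = (degree G u + degree G v) * nClose G u v * nClose G v u

  entry : Fin n → Fin n → ℕ
  entry u v = if adj G u v ∧ (toℕ u <ᵇ toℕ v) then edgeWeight u v else 0

  row : Fin n → ℕ
  row u = ∑ (entry u)

  wSz≡∑row : wSz G ≡ ∑ row
  wSz≡∑row = trans (sum-map-allFin (λ u → sumV G (entry u))) (sum-cong-≗ (λ u → sum-map-allFin (entry u)))

  edgeWeight-sym : ∀ u v → edgeWeight v u ≡ edgeWeight u v
  edgeWeight-sym u v = begin
    (dv + du) * kvu * kuv ≡⟨ cong (λ d → d * kvu * kuv) (+-comm dv du) ⟩
    (du + dv) * kvu * kuv ≡⟨ *-assoc (du + dv) kvu kuv ⟩
    (du + dv) * (kvu * kuv) ≡⟨ cong ((du + dv) *_) (*-comm kvu kuv) ⟩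
    (du + dv) * (kuv * kvu) ≡⟨ *-assoc (du + dv) kuv kvu ⟨
    (du + dv) * kuv * kvu ∎
    where
    open ≡-Reasoning
    du dv kuv kvu : ℕ
    du = degree G u
    dv = degree G v
    kuv = nClose G u v
    kvu = nClose G v u

  entry-+-entry : ∀ {u v} → Adj G u v → entry u v + entry v u ≡ edgeWeight u v
  entry-+-entry {u} {v} a rewrite a | adj-sym G a | edgeWeight-sym u v =
    one-of-two (toℕ u) (toℕ v) (edgeWeight u v) (adj⇒≢ G a ∘ toℕ-injective)
    where
    one-of-two : ∀ i j w → i ≢ j → (if i <ᵇ j then w else 0) + (if j <ᵇ i then w else 0) ≡ w
    one-of-two zero    zero    w i≢j = ⊥-elim (i≢j refl)
    one-of-two zero    (suc j) w _   = +-identityʳ w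
    one-of-two (suc i) zero    w _   = refl
    one-of-two (suc i) (suc j) w i≢j = one-of-two i j w (i≢j ∘ cong suc)

  row≡sum-neighbours : ∀ {u} (ns : List (Fin n)) → Unique ns → (∀ v → Adj G u v → v ∈ ns) →
    row u ≡ sum (map (entry u) ns)
  row≡sum-neighbours {u} ns uniq listed = trans (sum-cong-≗ off-list-zero) (∑-restrict-unique ns uniq (entry u))
    where
    off-list-zero : ∀ v → entry u v ≡ (if v ∈ᵇ ns then entry u v else 0)
    off-list-zero v with v ∈ᵇ ns in v∈ᵇ
    ... | true  = refl
    ... | false with adj G u v in a
    ... | false = refl
    ... | true with () ← trans (sym (∈⇒∈ᵇ (listed v a))) v∈ᵇ

-- Labelled vertices and rewiring

-- Checks about finitely many labelled vertices are stated on the labels, where they compute.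
module Labelling {k : ℕ} (vt : Fin k → Fin n) (vt-injective : ∀ {i j} → vt i ≡ vt j → i ≡ j) where

  vt-≡ᵇ : ∀ i j → (vt i ≡ᵇ vt j) ≡ (i ≡ᵇ j)
  vt-≡ᵇ i j with i ≟ j
  ... | yes refl = ≡ᵇ-refl (vt i)
  ... | no  i≢j  = ≢⇒≡ᵇ-false (i≢j ∘ vt-injective)

  vt-∈ᵇ : ∀ ls ℓ → (vt ℓ ∈ᵇ map vt ls) ≡ (ℓ ∈ᵇ ls)
  vt-∈ᵇ []       ℓ = refl
  vt-∈ᵇ (x ∷ ls) ℓ = cong₂ _∨_ (vt-≡ᵇ ℓ x) (vt-∈ᵇ ls ℓ)

  ∈ᵇ-map-vt : ∀ ls {x} → (x ∈ᵇ map vt ls) ≡ true → ∃ λ ℓ → ℓ ∈ ls × x ≡ vt ℓ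
  ∈ᵇ-map-vt ls {x} e = ∈-map⁻ vt (∈ᵇ⇒∈ {x = x} e)

  unique-map-vt : ∀ {ls} → Unique ls → Unique (map vt ls)
  unique-map-vt = UniqueP.map⁺ vt-injective

  NeighboursIn : SimpleGraph n → Fin k → List (Fin k) → Set
  NeighboursIn G ℓ ns = ∀ q → Adj G (vt ℓ) q → q ∈ map vt ns

  degree-by-labels : ∀ (G : SimpleGraph n) ℓ ns → Unique ns → NeighboursIn G ℓ ns →
    All (λ ℓ′ → Adj G (vt ℓ) (vt ℓ′)) ns → degree G (vt ℓ) ≡ length ns
  degree-by-labels G ℓ ns uniq listed adjs = begin
    degree G (vt ℓ)       ≡⟨ degree≡count G (vt ℓ) ⟩
    count (adj G (vt ℓ))  ≡⟨ count-cong (λ q → Bool-ext (∈⇒∈ᵇ ∘ listed q) (listed⇒adj q)) ⟩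
    count (_∈ᵇ map vt ns) ≡⟨ count-∈ᵇ (map vt ns) (unique-map-vt uniq) ⟩
    length (map vt ns)    ≡⟨ length-map vt ns ⟩
    length ns             ∎
    where
    open ≡-Reasoning
    listed⇒adj : ∀ q → (q ∈ᵇ map vt ns) ≡ true → adj G (vt ℓ) q ≡ true
    listed⇒adj q e with ∈ᵇ-map-vt ns {q} e
    ... | ℓ′ , ℓ′∈ , refl = All.lookup adjs ℓ′∈

  onlyExit : List (Fin k) → (Fin k → List (Fin k)) → Fin k → Fin k → Bool
  onlyExit ls N u v = all (λ ℓ → all (λ ℓ′ → (ℓ′ ∈ᵇ ls) ∨ ((ℓ ≡ᵇ u) ∧ (ℓ′ ≡ᵇ v))) (N ℓ)) ls

  cut-by-labels : ∀ (G : SimpleGraph n) ls N u v → (∀ ℓ → ℓ ∈ ls → NeighboursIn G ℓ (N ℓ)) →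
    onlyExit ls N u v ≡ true → Cut G (_∈ᵇ map vt ls) (vt u) (vt v)
  cut-by-labels G ls N u v nbrs exit p q a p∈ q∉ with ∈ᵇ-map-vt ls {p} p∈
  ... | ℓ , ℓ∈ , refl with ∈-map⁻ vt (nbrs ℓ ℓ∈ q a)
  ... | ℓ′ , ℓ′∈ , refl
    with ∨-true {ℓ′ ∈ᵇ ls} (all-true⇒ _ (all-true⇒ (λ ℓ → all _ (N ℓ)) exit ℓ∈) ℓ′∈)
  ... | inj₁ ℓ′∈ᵇ with () ← trans (sym (trans (vt-∈ᵇ ls ℓ′) ℓ′∈ᵇ)) q∉
  ... | inj₂ uv = let (ℓ≡u , ℓ′≡v) = ∧-true {ℓ ≡ᵇ u} uv in cong vt (≡ᵇ⇒≡ ℓ≡u) , cong vt (≡ᵇ⇒≡ ℓ′≡v)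

  IsBranch : (Fin k → List (Fin k)) → List (Fin k) → Fin k → Fin k → Bool
  IsBranch N ls u v = onlyExit ls N u v ∧ ((u ∈ᵇ ls) ∧ not (v ∈ᵇ ls))

  nClose-branch : ∀ (G : SimpleGraph n) → Connected G → ∀ N ls u v → (∀ ℓ → ℓ ∈ ls → NeighboursIn G ℓ (N ℓ)) →
    IsBranch N ls u v ≡ true → Unique ls → Adj G (vt u) (vt v) →
    nClose G (vt u) (vt v) ≡ length ls × length ls + nClose G (vt v) (vt u) ≡ n
  nClose-branch G conn N ls u v nbrs branch uniq a = nClose-uv , (begin
      length ls + nClose G (vt v) (vt u)      ≡⟨ cong₂ _+_ (sym count≡length) nClose-vu ⟩
      count inLs + count (not ∘ inLs)         ≡⟨ count-+-count-not inLs ⟩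
      n                                       ∎)
    where
    open ≡-Reasoning
    inLs : Fin n → Bool
    inLs = _∈ᵇ map vt ls
    exit : onlyExit ls N u v ≡ true
    exit = ∧-conicalˡ (onlyExit ls N u v) _ branch
    ends : (u ∈ᵇ ls) ≡ true × not (v ∈ᵇ ls) ≡ true
    ends = ∧-true {u ∈ᵇ ls} (∧-conicalʳ (onlyExit ls N u v) _ branch)
    u∈ : inLs (vt u) ≡ true
    u∈ = trans (vt-∈ᵇ ls u) (proj₁ ends)
    v∉ : inLs (vt v) ≡ false
    v∉ = trans (vt-∈ᵇ ls v) (trans (sym (not-involutive (v ∈ᵇ ls))) (cong not (proj₂ ends)))
    cut : Cut G inLs (vt u) (vt v)
    cut = cut-by-labels G ls N u v nbrs exit
    count≡length : count inLs ≡ length ls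
    count≡length = trans (count-∈ᵇ (map vt ls) (unique-map-vt uniq)) (length-map vt ls)
    nClose-uv : nClose G (vt u) (vt v) ≡ length ls
    nClose-uv = trans (nClose-cut G conn cut a u∈ v∉) count≡length
    nClose-vu : nClose G (vt v) (vt u) ≡ count (not ∘ inLs)
    nClose-vu = nClose-cut G conn (cut-complement G cut) (adj-sym G a) (cong not v∉) (cong not u∈)

  sum-rows-by-labels : ∀ (G : SimpleGraph n) (N : Fin k → List (Fin k)) ls →
    (∀ ℓ → ℓ ∈ ls → NeighboursIn G ℓ (N ℓ)) → (∀ ℓ → Unique (N ℓ)) →
    sum (map (row G) (map vt ls)) ≡ sum (map (λ ℓ → sum (map (entry G (vt ℓ)) (map vt (N ℓ)))) ls)
  sum-rows-by-labels G N []       _    _    = refl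
  sum-rows-by-labels G N (ℓ ∷ ls) nbrs uniq =
    cong₂ _+_ (row≡sum-neighbours G (map vt (N ℓ)) (unique-map-vt (uniq ℓ)) (nbrs ℓ (here refl)))
              (sum-rows-by-labels G N ls (λ ℓ′ ℓ′∈ → nbrs ℓ′ (there ℓ′∈)) uniq)

  joinsᵇ : Fin k × Fin k → Fin k → Fin k → Bool
  joinsᵇ (p , q) i j = ((i ≡ᵇ p) ∧ (j ≡ᵇ q)) ∨ ((i ≡ᵇ q) ∧ (j ≡ᵇ p))

  joins : Fin k × Fin k → Fin n → Fin n → Bool
  joins (p , q) x y = ((x ≡ᵇ vt p) ∧ (y ≡ᵇ vt q)) ∨ ((x ≡ᵇ vt q) ∧ (y ≡ᵇ vt p))

  joins-vt : ∀ e i j → joins e (vt i) (vt j) ≡ joinsᵇ e i j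
  joins-vt (p , q) i j rewrite vt-≡ᵇ i p | vt-≡ᵇ j q | vt-≡ᵇ i q | vt-≡ᵇ j p = refl

  joins-sym : ∀ e x y → joins e x y ≡ joins e y x
  joins-sym (p , q) x y rewrite ∧-comm (y ≡ᵇ vt p) (x ≡ᵇ vt q) | ∧-comm (y ≡ᵇ vt q) (x ≡ᵇ vt p) =
    ∨-comm ((x ≡ᵇ vt p) ∧ (y ≡ᵇ vt q)) _

  joins⇒ : ∀ e x y → joins e x y ≡ true →
    (x ≡ vt (proj₁ e) × y ≡ vt (proj₂ e)) ⊎ (x ≡ vt (proj₂ e) × y ≡ vt (proj₁ e))
  joins⇒ (p , q) x y e with ∨-true {(x ≡ᵇ vt p) ∧ (y ≡ᵇ vt q)} e
  ... | inj₁ h = let (h₁ , h₂) = ∧-true {x ≡ᵇ vt p} h in inj₁ (≡ᵇ⇒≡ h₁ , ≡ᵇ⇒≡ h₂)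
  ... | inj₂ h = let (h₁ , h₂) = ∧-true {x ≡ᵇ vt q} h in inj₂ (≡ᵇ⇒≡ h₁ , ≡ᵇ⇒≡ h₂)

  module Rewire (G : SimpleGraph n) (S : List (Fin k)) (E : List (Fin k × Fin k))
    (loopless : all (λ e → not (proj₁ e ≡ᵇ proj₂ e)) E ≡ true) where

    inS : Fin n → Bool
    inS x = x ∈ᵇ map vt S

    edgeᵇ : Fin k → Fin k → Bool
    edgeᵇ i j = any (λ e → joinsᵇ e i j) E

    private
      new : Fin n → Fin n → Bool
      new x y = any (λ e → joins e x y) E

      adj′ : Fin n → Fin n → Bool
      adj′ x y = (not (inS x) ∧ (not (inS y) ∧ adj G x y)) ∨ new x y

      adj′-sym : ∀ x y → adj′ x y ≡ adj′ y x
      adj′-sym x y rewrite SimpleGraph.sym G x y | any-cong {p = λ e → joins e x y} E (λ e → joins-sym e x y)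
        with inS x | inS y
      ... | true  | true  = refl
      ... | true  | false = refl
      ... | false | true  = refl
      ... | false | false = refl

      adj′-irrefl : ∀ x → adj′ x x ≡ false
      adj′-irrefl x rewrite SimpleGraph.irrefl G x | ∧-zeroʳ (not (inS x)) | ∧-zeroʳ (not (inS x)) =
        any-false _ E no-loop
        where
        half : ∀ p q → p ≢ q → ((x ≡ᵇ vt p) ∧ (x ≡ᵇ vt q)) ≡ false
        half p q p≢q with x ≟ vt p
        ... | yes refl = ≢⇒≡ᵇ-false (p≢q ∘ vt-injective)
        ... | no  _    = refl
        distinct : ∀ {p q} → (p , q) ∈ E → p ≢ q
        distinct {p} e∈ refl with () ← trans (sym (cong not (≡ᵇ-refl p))) (all-true⇒ _ loopless e∈)
        no-loop : ∀ e → e ∈ E → joins e x x ≡ false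
        no-loop (p , q) e∈ rewrite half p q (distinct e∈) | half q p (distinct e∈ ∘ sym) = refl

    rewired : SimpleGraph n
    rewired = record { adj = adj′ ; sym = adj′-sym ; irrefl = adj′-irrefl }

    edgeᵇ⇒Adj : ∀ i j → edgeᵇ i j ≡ true → Adj rewired (vt i) (vt j)
    edgeᵇ⇒Adj i j e = trans (cong (old ∨_) (trans (any-cong E (λ e → joins-vt e i j)) e)) (∨-zeroʳ old)
      where old = not (inS (vt i)) ∧ (not (inS (vt j)) ∧ adj G (vt i) (vt j))

    neighboursIn-rewired : (N : Fin k → List (Fin k)) →
      all (λ e → (proj₂ e ∈ᵇ N (proj₁ e)) ∧ (proj₁ e ∈ᵇ N (proj₂ e))) E ≡ true →
      ∀ ℓ → ℓ ∈ S → NeighboursIn rewired ℓ (N ℓ)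
    neighboursIn-rewired N listed ℓ ℓ∈S q a
      with any-true⇒∃ _ E (trans (cong (λ b → (not b ∧ (not (inS q) ∧ adj G (vt ℓ) q)) ∨ new (vt ℓ) q) (sym ℓ∈ᵇS)) a)
      where ℓ∈ᵇS = trans (vt-∈ᵇ S ℓ) (∈⇒∈ᵇ ℓ∈S)
    ... | (p , p′) , e∈ , j with all-true⇒ _ listed e∈ | joins⇒ (p , p′) (vt ℓ) q j
    ... | h | inj₁ (e₁ , refl) rewrite vt-injective e₁ = ∈-map⁺ vt (∈ᵇ⇒∈ (∧-conicalˡ (p′ ∈ᵇ N p) _ h))
    ... | h | inj₂ (e₁ , refl) rewrite vt-injective e₁ = ∈-map⁺ vt (∈ᵇ⇒∈ (∧-conicalʳ (p′ ∈ᵇ N p) _ h))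

    agree-outside : all (λ e → (proj₁ e ∈ᵇ S) ∨ (proj₂ e ∈ᵇ S)) E ≡ true →
      ∀ x y → inS x ≡ false → inS y ≡ false → adj G x y ≡ adj rewired x y
    agree-outside inside x y Sx Sy rewrite Sx | Sy =
      sym (trans (cong (adj G x y ∨_) (any-false _ E not-new)) (∨-identityʳ _))
      where
      labelled-in-S : ∀ ℓ → ℓ ∈ᵇ S ≡ true → inS (vt ℓ) ≡ true
      labelled-in-S ℓ e = trans (vt-∈ᵇ S ℓ) e
      not-new : ∀ e → e ∈ E → joins e x y ≡ false
      not-new (p , q) e∈ with joins (p , q) x y in j
      ... | false = refl
      ... | true with ∨-true {p ∈ᵇ S} (all-true⇒ _ inside e∈) | joins⇒ (p , q) x y j
      ... | inj₁ pS | inj₁ (refl , refl) with () ← trans (sym Sx) (labelled-in-S p pS)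
      ... | inj₂ qS | inj₁ (refl , refl) with () ← trans (sym Sy) (labelled-in-S q qS)
      ... | inj₁ pS | inj₂ (refl , refl) with () ← trans (sym Sy) (labelled-in-S p pS)
      ... | inj₂ qS | inj₂ (refl , refl) with () ← trans (sym Sx) (labelled-in-S q qS)

    IsWalkᵇ : Fin k → List (Fin k) → Fin k → Bool
    IsWalkᵇ ℓ []        ℓ′ = ℓ ≡ᵇ ℓ′
    IsWalkᵇ ℓ (ℓ₁ ∷ ls) ℓ′ = edgeᵇ ℓ ℓ₁ ∧ IsWalkᵇ ℓ₁ ls ℓ′

    isWalkᵇ⇒Walk : ∀ ℓ ls ℓ′ → IsWalkᵇ ℓ ls ℓ′ ≡ true → Walk rewired (vt ℓ) (vt ℓ′) (length ls)
    isWalkᵇ⇒Walk ℓ []        ℓ′ e rewrite ≡ᵇ⇒≡ {x = ℓ} {ℓ′} e = here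
    isWalkᵇ⇒Walk ℓ (ℓ₁ ∷ ls) ℓ′ e =
      let (e₁ , e₂) = ∧-true {edgeᵇ ℓ ℓ₁} e in step (edgeᵇ⇒Adj ℓ ℓ₁ e₁) (isWalkᵇ⇒Walk ℓ₁ ls ℓ′ e₂)

    edgesᵇ⇒All-Adj : ∀ ℓ ns → all (edgeᵇ ℓ) ns ≡ true → All (λ ℓ′ → Adj rewired (vt ℓ) (vt ℓ′)) ns
    edgesᵇ⇒All-Adj ℓ ns e = All.tabulate (λ {ℓ′} ℓ′∈ → edgeᵇ⇒Adj ℓ ℓ′ (all-true⇒ (edgeᵇ ℓ) e ℓ′∈))

-- Two 3-rays at a vertex of degree 3

module RayProperties {T : SimpleGraph n} {r : Fin n} (ρ : Ray3 T r) where
  open Ray3 ρ public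

  r≢r₁ : r ≢ r₁
  r≢r₁ with distinct
  ... | (r≢r₁ ∷ _) ∷ _ = r≢r₁
  r≢r₂ : r ≢ r₂
  r≢r₂ with distinct
  ... | (_ ∷ r≢r₂ ∷ _) ∷ _ = r≢r₂
  r≢r₃ : r ≢ r₃
  r≢r₃ with distinct
  ... | (_ ∷ _ ∷ r≢r₃ ∷ _) ∷ _ = r≢r₃
  r₁≢r₂ : r₁ ≢ r₂
  r₁≢r₂ with distinct
  ... | _ ∷ (r₁≢r₂ ∷ _) ∷ _ = r₁≢r₂
  r₁≢r₃ : r₁ ≢ r₃
  r₁≢r₃ with distinct
  ... | _ ∷ (_ ∷ r₁≢r₃ ∷ _) ∷ _ = r₁≢r₃
  r₂≢r₃ : r₂ ≢ r₃
  r₂≢r₃ with distinct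
  ... | _ ∷ _ ∷ (r₂≢r₃ ∷ _) ∷ _ = r₂≢r₃

  neighbours-r₁ : ∀ {q} → Adj T r₁ q → q ∈ (r ∷ r₂ ∷ [])
  neighbours-r₁ = neighbour-listed T deg₁ ((r≢r₂ ∷ []) ∷ [] ∷ []) (adj-sym T adj₀₁ ∷ adj₁₂ ∷ [])

  neighbours-r₂ : ∀ {q} → Adj T r₂ q → q ∈ (r₁ ∷ r₃ ∷ [])
  neighbours-r₂ = neighbour-listed T deg₂ ((r₁≢r₃ ∷ []) ∷ [] ∷ []) (adj-sym T adj₁₂ ∷ adj₂₃ ∷ [])

  neighbours-r₃ : ∀ {q} → Adj T r₃ q → q ∈ (r₂ ∷ [])
  neighbours-r₃ = neighbour-listed T deg₃ ([] ∷ []) (adj-sym T adj₂₃ ∷ [])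

  r≁r₂ : ¬ Adj T r₂ r
  r≁r₂ a with neighbours-r₂ a
  ... | here r≡r₁         = r≢r₁ r≡r₁
  ... | there (here r≡r₃) = r≢r₃ r≡r₃

  r≁r₃ : ¬ Adj T r₃ r
  r≁r₃ a with neighbours-r₃ a
  ... | here r≡r₂ = r≢r₂ r≡r₂

module TwoRays {T : SimpleGraph n} {r : Fin n} (ρ σ : Ray3 T r) (r₁≢r₁′ : Ray3.r₁ ρ ≢ Ray3.r₁ σ) where
  module ρ = RayProperties ρ
  module σ = RayProperties σ

  r₁≢r₂′ : ρ.r₁ ≢ σ.r₂
  r₁≢r₂′ refl = σ.r≁r₂ (adj-sym T ρ.adj₀₁)

  r₁≢r₃′ : ρ.r₁ ≢ σ.r₃
  r₁≢r₃′ refl = σ.r≁r₃ (adj-sym T ρ.adj₀₁)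

  r₂≢r₂′ : ρ.r₂ ≢ σ.r₂
  r₂≢r₂′ refl with σ.neighbours-r₂ (adj-sym T ρ.adj₁₂)
  ... | here r₁≡r₁′         = r₁≢r₁′ r₁≡r₁′
  ... | there (here r₁≡r₃′) = r₁≢r₃′ r₁≡r₃′

  r₂≢r₃′ : ρ.r₂ ≢ σ.r₃
  r₂≢r₃′ refl with σ.neighbours-r₃ (adj-sym T ρ.adj₁₂)
  ... | here r₁≡r₂′ = r₁≢r₂′ r₁≡r₂′

  r₃≢r₃′ : ρ.r₃ ≢ σ.r₃
  r₃≢r₃′ refl with σ.neighbours-r₃ (adj-sym T ρ.adj₂₃)
  ... | here r₂≡r₂′ = r₂≢r₂′ r₂≡r₂′

pattern ℓc  = 0F
pattern ℓr  = 1F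
pattern ℓa₁ = 2F
pattern ℓa₂ = 3F
pattern ℓa₃ = 4F
pattern ℓb₁ = 5F
pattern ℓb₂ = 6F
pattern ℓb₃ = 7F

rayLabels : List (Fin 8)
rayLabels = ℓr ∷ ℓa₁ ∷ ℓa₂ ∷ ℓa₃ ∷ ℓb₁ ∷ ℓb₂ ∷ ℓb₃ ∷ []

neighboursT : Fin 8 → List (Fin 8)
neighboursT ℓc  = ℓr ∷ []
neighboursT ℓr  = ℓa₁ ∷ ℓb₁ ∷ ℓc ∷ []
neighboursT ℓa₁ = ℓr ∷ ℓa₂ ∷ []
neighboursT ℓa₂ = ℓa₁ ∷ ℓa₃ ∷ []
neighboursT ℓa₃ = ℓa₂ ∷ []
neighboursT ℓb₁ = ℓr ∷ ℓb₂ ∷ []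
neighboursT ℓb₂ = ℓb₁ ∷ ℓb₃ ∷ []
neighboursT ℓb₃ = ℓb₂ ∷ []

-- r, a₁, a₂, a₃ and r, b₁, b₂, b₃ become r, a₁, a₂ and r, b₁, b₂ and r, a₃, b₃.
newEdges : List (Fin 8 × Fin 8)
newEdges = (ℓr , ℓa₁) ∷ (ℓa₁ , ℓa₂) ∷ (ℓr , ℓb₁) ∷ (ℓb₁ , ℓb₂) ∷ (ℓr , ℓa₃) ∷ (ℓa₃ , ℓb₃) ∷ (ℓr , ℓc) ∷ []

neighboursT′ : Fin 8 → List (Fin 8)
neighboursT′ ℓc  = ℓr ∷ []
neighboursT′ ℓr  = ℓa₁ ∷ ℓb₁ ∷ ℓc ∷ ℓa₃ ∷ []
neighboursT′ ℓa₁ = ℓr ∷ ℓa₂ ∷ []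
neighboursT′ ℓa₂ = ℓa₁ ∷ []
neighboursT′ ℓa₃ = ℓr ∷ ℓb₃ ∷ []
neighboursT′ ℓb₁ = ℓr ∷ ℓb₂ ∷ []
neighboursT′ ℓb₂ = ℓb₁ ∷ []
neighboursT′ ℓb₃ = ℓa₃ ∷ []

-- a walk in T′ replacing the edge ℓ ℓ′ of T
detour : Fin 8 → Fin 8 → List (Fin 8)
detour ℓa₂ ℓa₃ = ℓa₁ ∷ ℓr ∷ ℓa₃ ∷ []
detour ℓa₃ ℓa₂ = ℓr ∷ ℓa₁ ∷ ℓa₂ ∷ []
detour ℓb₂ ℓb₃ = ℓb₁ ∷ ℓr ∷ ℓa₃ ∷ ℓb₃ ∷ []
detour ℓb₃ ℓb₂ = ℓa₃ ∷ ℓr ∷ ℓb₁ ∷ ℓb₂ ∷ []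
detour _   ℓ′  = ℓ′ ∷ []

-- The edges a₁r, a₂a₁, a₃a₂, b₁r, b₂b₁, b₃b₂, rc of T and a₁r, a₂a₁, b₁r, b₂b₁, a₃r, b₃a₃, rc of T′,
-- when n = 8 + m and c has degree d.
weightsT : ℕ → ℕ → ℕ
weightsT m d = (2 + 3) * 3 * (5 + m) + (2 + 2) * 2 * (6 + m) + (1 + 2) * 1 * (7 + m)
             + (2 + 3) * 3 * (5 + m) + (2 + 2) * 2 * (6 + m) + (1 + 2) * 1 * (7 + m) + (3 + d) * 7 * (1 + m)

weightsT′ : ℕ → ℕ → ℕ
weightsT′ m d = (2 + 4) * 2 * (6 + m) + (1 + 2) * 1 * (7 + m) + (2 + 4) * 2 * (6 + m) + (1 + 2) * 1 * (7 + m)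
              + (2 + 4) * 2 * (6 + m) + (1 + 2) * 1 * (7 + m) + (4 + d) * 7 * (1 + m)

weightsT≡weightsT′+2 : ∀ m d → weightsT m d ≡ weightsT′ m d + 2
weightsT≡weightsT′+2 = expanded
  where
  -- The solver does not unfold weightsT and weightsT′.
  expanded : ∀ m d →
      (2 + 3) * 3 * (5 + m) + (2 + 2) * 2 * (6 + m) + (1 + 2) * 1 * (7 + m)
    + (2 + 3) * 3 * (5 + m) + (2 + 2) * 2 * (6 + m) + (1 + 2) * 1 * (7 + m) + (3 + d) * 7 * (1 + m)
    ≡ (2 + 4) * 2 * (6 + m) + (1 + 2) * 1 * (7 + m) + (2 + 4) * 2 * (6 + m) + (1 + 2) * 1 * (7 + m)
    + (2 + 4) * 2 * (6 + m) + (1 + 2) * 1 * (7 + m) + (4 + d) * 7 * (1 + m) + 2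
  expanded = solve-∀

+-cong₇ : ∀ {a₁ a₂ a₃ a₄ a₅ a₆ a₇ b₁ b₂ b₃ b₄ b₅ b₆ b₇ : ℕ} → a₁ ≡ b₁ → a₂ ≡ b₂ → a₃ ≡ b₃ → a₄ ≡ b₄ →
  a₅ ≡ b₅ → a₆ ≡ b₆ → a₇ ≡ b₇ → a₁ + a₂ + a₃ + a₄ + a₅ + a₆ + a₇ ≡ b₁ + b₂ + b₃ + b₄ + b₅ + b₆ + b₇
+-cong₇ refl refl refl refl refl refl refl = refl

regroupT : ∀ r-a₁ r-b₁ r-c a₁-r a₁-a₂ a₂-a₁ a₂-a₃ a₃-a₂ b₁-r b₁-b₂ b₂-b₁ b₂-b₃ b₃-b₂ c-r →
    (r-a₁ + (r-b₁ + (r-c + 0))) + ((a₁-r + (a₁-a₂ + 0)) + ((a₂-a₁ + (a₂-a₃ + 0)) + ((a₃-a₂ + 0)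
      + ((b₁-r + (b₁-b₂ + 0)) + ((b₂-b₁ + (b₂-b₃ + 0)) + ((b₃-b₂ + 0) + 0)))))) + c-r
  ≡ (a₁-r + r-a₁) + (a₂-a₁ + a₁-a₂) + (a₃-a₂ + a₂-a₃) + (b₁-r + r-b₁) + (b₂-b₁ + b₁-b₂) + (b₃-b₂ + b₂-b₃) + (r-c + c-r)
regroupT = solve-∀

regroupT′ : ∀ r-a₁ r-b₁ r-c r-a₃ a₁-r a₁-a₂ a₂-a₁ a₃-r a₃-b₃ b₁-r b₁-b₂ b₂-b₁ b₃-a₃ c-r →
    (r-a₁ + (r-b₁ + (r-c + (r-a₃ + 0)))) + ((a₁-r + (a₁-a₂ + 0)) + ((a₂-a₁ + 0) + ((a₃-r + (a₃-b₃ + 0))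
      + ((b₁-r + (b₁-b₂ + 0)) + ((b₂-b₁ + 0) + ((b₃-a₃ + 0) + 0)))))) + c-r
  ≡ (a₁-r + r-a₁) + (a₂-a₁ + a₁-a₂) + (b₁-r + r-b₁) + (b₂-b₁ + b₁-b₂) + (a₃-r + r-a₃) + (b₃-a₃ + a₃-b₃) + (r-c + c-r)
regroupT′ = solve-∀

-- s, x, p, e: the index, the row of c, the rows of the rays and the entry at (c, r), before and after.
difference-of-two : ∀ {s s′ x x′ p p′ e e′ : ℕ} → s + (x′ + p′) ≡ s′ + (x + p) → x + e′ ≡ x′ + e →
  p + e ≡ p′ + e′ + 2 → s ≡ s′ + 2
difference-of-two {s} {s′} {x} {x′} {p} {p′} {e} {e′} outside row-c rays =
  +-cancelʳ-≡ ((x′ + p′) + (x + e′)) s (s′ + 2) (begin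
    s + ((x′ + p′) + (x + e′))   ≡⟨ +-assoc s _ _ ⟨
    (s + (x′ + p′)) + (x + e′)   ≡⟨ cong₂ _+_ outside row-c ⟩
    (s′ + (x + p)) + (x′ + e)    ≡⟨ shuffle s′ x p x′ e ⟩
    s′ + x + x′ + (p + e)        ≡⟨ cong (s′ + x + x′ +_) rays ⟩
    s′ + x + x′ + (p′ + e′ + 2)  ≡⟨ shuffle′ s′ x x′ p′ e′ ⟩
    (s′ + 2) + ((x′ + p′) + (x + e′)) ∎)
  where
  open ≡-Reasoning
  shuffle : ∀ s′ x p x′ e → (s′ + (x + p)) + (x′ + e) ≡ s′ + x + x′ + (p + e)
  shuffle = solve-∀
  shuffle′ : ∀ s′ x x′ p′ e′ → s′ + x + x′ + (p′ + e′ + 2) ≡ (s′ + 2) + ((x′ + p′) + (x + e′))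
  shuffle′ = solve-∀

module TwoRaysAtDegreeThree {T : SimpleGraph n} (tree : IsTree T) {r : Fin n} (deg-r : degree T r ≡ 3)
  (ρ σ : Ray3 T r) (a₁≢b₁ : Ray3.r₁ ρ ≢ Ray3.r₁ σ) where

  module ρ = RayProperties ρ
  module σ = RayProperties σ
  module ρσ = TwoRays ρ σ a₁≢b₁
  module σρ = TwoRays σ ρ (a₁≢b₁ ∘ sym)
  open Ray3 ρ using () renaming (r₁ to a₁; r₂ to a₂; r₃ to a₃)
  open Ray3 σ using () renaming (r₁ to b₁; r₂ to b₂; r₃ to b₃)

  private
    third-neighbour : ∃ λ c → Adj T r c × c ∉ (a₁ ∷ b₁ ∷ [])
    third-neighbour = unlisted-neighbour T ((a₁≢b₁ ∷ []) ∷ [] ∷ []) deg-r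

  c : Fin n
  c = proj₁ third-neighbour

  r-c : Adj T r c
  r-c = proj₁ (proj₂ third-neighbour)

  r≢c : r ≢ c
  r≢c = adj⇒≢ T r-c

  first≢c : ∀ {x} → x ∈ (a₁ ∷ b₁ ∷ []) → x ≢ c
  first≢c x∈ x≡c = proj₂ (proj₂ third-neighbour) (subst (_∈ _) x≡c x∈)

  r₂≢c : ∀ (τ : Ray3 T r) → Ray3.r₂ τ ≢ c
  r₂≢c τ r₂≡c = RayProperties.r≁r₂ τ (subst (λ t → Adj T t r) (sym r₂≡c) (adj-sym T r-c))

  r₃≢c : ∀ (τ : Ray3 T r) → Ray3.r₃ τ ≢ c
  r₃≢c τ r₃≡c = RayProperties.r≁r₃ τ (subst (λ t → Adj T t r) (sym r₃≡c) (adj-sym T r-c))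

  neighbours-r : ∀ {q} → Adj T r q → q ∈ (a₁ ∷ b₁ ∷ c ∷ [])
  neighbours-r = neighbour-listed T deg-r
    ((a₁≢b₁ ∷ first≢c (here refl) ∷ []) ∷ (first≢c (there (here refl)) ∷ []) ∷ [] ∷ []) (ρ.adj₀₁ ∷ σ.adj₀₁ ∷ r-c ∷ [])

  vt : Fin 8 → Fin n
  vt ℓc  = c
  vt ℓr  = r
  vt ℓa₁ = a₁
  vt ℓa₂ = a₂
  vt ℓa₃ = a₃
  vt ℓb₁ = b₁
  vt ℓb₂ = b₂
  vt ℓb₃ = b₃

  labelled-vertices-distinct : Unique (map vt (allFin 8))
  labelled-vertices-distinct =
    ((r≢c ∘ sym) ∷ (first≢c (here refl) ∘ sym) ∷ (r₂≢c ρ ∘ sym) ∷ (r₃≢c ρ ∘ sym) ∷ (first≢c (there (here refl)) ∘ sym) ∷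
       (r₂≢c σ ∘ sym) ∷ (r₃≢c σ ∘ sym) ∷ []) ∷
    (ρ.r≢r₁ ∷ ρ.r≢r₂ ∷ ρ.r≢r₃ ∷ σ.r≢r₁ ∷ σ.r≢r₂ ∷ σ.r≢r₃ ∷ []) ∷
    (ρ.r₁≢r₂ ∷ ρ.r₁≢r₃ ∷ a₁≢b₁ ∷ ρσ.r₁≢r₂′ ∷ ρσ.r₁≢r₃′ ∷ []) ∷
    (ρ.r₂≢r₃ ∷ (σρ.r₁≢r₂′ ∘ sym) ∷ ρσ.r₂≢r₂′ ∷ ρσ.r₂≢r₃′ ∷ []) ∷
    ((σρ.r₁≢r₃′ ∘ sym) ∷ (σρ.r₂≢r₃′ ∘ sym) ∷ ρσ.r₃≢r₃′ ∷ []) ∷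
    (σ.r₁≢r₂ ∷ σ.r₁≢r₃ ∷ []) ∷
    (σ.r₂≢r₃ ∷ []) ∷ [] ∷ []

  vt-injective : ∀ {i j} → vt i ≡ vt j → i ≡ j
  vt-injective = map-injective-on labelled-vertices-distinct (∈-allFin _) (∈-allFin _)

  open Labelling vt vt-injective public

  neighboursIn-T : ∀ ℓ → ℓ ∈ rayLabels → NeighboursIn T ℓ (neighboursT ℓ)
  neighboursIn-T _ (here refl)                                         _ = neighbours-r
  neighboursIn-T _ (there (here refl))                                 _ = ρ.neighbours-r₁
  neighboursIn-T _ (there (there (here refl)))                         _ = ρ.neighbours-r₂
  neighboursIn-T _ (there (there (there (here refl))))                 _ = ρ.neighbours-r₃
  neighboursIn-T _ (there (there (there (there (here refl)))))         _ = σ.neighbours-r₁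
  neighboursIn-T _ (there (there (there (there (there (here refl)))))) _ = σ.neighbours-r₂
  neighboursIn-T _ (there (there (there (there (there (there (here refl))))))) _ = σ.neighbours-r₃

  inRays : Fin n → Bool
  inRays x = x ∈ᵇ map vt rayLabels

  open Rewire T rayLabels newEdges refl public
    using (edgeᵇ; edgeᵇ⇒Adj; IsWalkᵇ; isWalkᵇ⇒Walk; edgesᵇ⇒All-Adj) renaming (rewired to T′)

  neighboursIn-T′ : ∀ ℓ → ℓ ∈ rayLabels → NeighboursIn T′ ℓ (neighboursT′ ℓ)
  neighboursIn-T′ = Rewire.neighboursIn-rewired T rayLabels newEdges refl neighboursT′ refl

  cut-T : Cut T inRays r c
  cut-T = cut-by-labels T rayLabels neighboursT ℓr ℓc neighboursIn-T refl

  cut-T′ : Cut T′ inRays r c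
  cut-T′ = cut-by-labels T′ rayLabels neighboursT′ ℓr ℓc neighboursIn-T′ refl

  r-c′ : Adj T′ r c
  r-c′ = edgeᵇ⇒Adj ℓr ℓc refl

  agree-off-rays : ∀ x y → inRays x ≡ false → inRays y ≡ false → adj T x y ≡ adj T′ x y
  agree-off-rays = Rewire.agree-outside T rayLabels newEdges refl refl

  adj-off-rays : ∀ u v → inRays u ≡ false → adj T u v ≡ adj T′ u v
  adj-off-rays u v u∉ = by-side (inRays v) refl
    where
    via-r-c : ∀ G {H} → Cut H inRays r c → inRays v ≡ true → Adj H v u → Adj G r c → Adj G u v
    via-r-c G cut v∈ a r-c-G with cut v u a v∈ u∉
    ... | refl , refl = adj-sym G r-c-G
    by-side : ∀ b → inRays v ≡ b → adj T u v ≡ adj T′ u v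
    by-side false v∉ = agree-off-rays u v u∉ v∉
    by-side true  v∈ = Bool-ext (λ a → via-r-c T′ {T} cut-T v∈ (adj-sym T {u} {v} a) r-c′)
                                (λ a → via-r-c T {T′} cut-T′ v∈ (adj-sym T′ {u} {v} a) r-c)

  T′-connected : Connected T′
  T′-connected = connected-transfer T T′ inRays adj-off-rays (proj₁ tree) bridge
    where
    detour-ok : Fin 8 → Fin 8 → Bool
    detour-ok ℓ ℓ′ = IsWalkᵇ ℓ (detour ℓ ℓ′) ℓ′
    detours-ok : all (λ ℓ → all (detour-ok ℓ) (neighboursT ℓ)) rayLabels ≡ true
    detours-ok = refl
    bridge : ∀ {x y} → inRays x ≡ true → Adj T x y → ∃ λ k → Walk T′ x y k
    bridge {x} {y} x∈ a with ∈ᵇ-map-vt rayLabels {x} x∈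
    ... | ℓ , ℓ∈ , refl with ∈-map⁻ vt (neighboursIn-T ℓ ℓ∈ y a)
    ... | ℓ′ , ℓ′∈ , refl = _ , isWalkᵇ⇒Walk ℓ (detour ℓ ℓ′) ℓ′
      (all-true⇒ (detour-ok ℓ) (all-true⇒ (λ ℓ → all (detour-ok ℓ) (neighboursT ℓ)) detours-ok ℓ∈) ℓ′∈)

  -- Peel off the leaves a₂, b₂, b₃, then a₁, b₁, a₃, then r.
  rays-off-cycles : ∀ {x ys y} → 1 ≤ length ys → Linked (Adj T′) (x ∷ (ys ∷ʳ y)) → Unique (x ∷ (ys ∷ʳ y)) →
    Adj T′ y x → All (λ z → inRays z ≡ false) (x ∷ (ys ∷ʳ y))
  rays-off-cycles {x} {ys} {y} len path uniq closing = All.tabulate outside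
    where
    OnCycle : Fin 8 → Set
    OnCycle ℓ = vt ℓ ∈ (x ∷ (ys ∷ʳ y))

    two-neighbours : ∀ ℓ → ℓ ∈ rayLabels → OnCycle ℓ →
      ∃ λ p → ∃ λ q → p ∈ neighboursT′ ℓ × q ∈ neighboursT′ ℓ × p ≢ q × OnCycle p × OnCycle q
    two-neighbours ℓ ℓ∈ on = labelled
      (cycle-two-neighbours {R = Adj T′} (λ {a} {b} → adj-sym T′ {a} {b}) x ys y (vt ℓ) len path uniq closing on)
      where
      labelled : TwoNeighboursIn (Adj T′) (x ∷ (ys ∷ʳ y)) (vt ℓ) →
        ∃ λ p → ∃ λ q → p ∈ neighboursT′ ℓ × q ∈ neighboursT′ ℓ × p ≢ q × OnCycle p × OnCycle q
      labelled (p , q , p∈ , q∈ , p≢q , ap , aq) =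
        let (ℓp , ℓp∈ , p≡) = ∈-map⁻ vt (neighboursIn-T′ ℓ ℓ∈ p ap)
            (ℓq , ℓq∈ , q≡) = ∈-map⁻ vt (neighboursIn-T′ ℓ ℓ∈ q aq)
        in ℓp , ℓq , ℓp∈ , ℓq∈ , (λ ℓp≡ℓq → p≢q (trans p≡ (trans (cong vt ℓp≡ℓq) (sym q≡)))) ,
           subst (_∈ _) p≡ p∈ , subst (_∈ _) q≡ q∈

    leaf : ∀ {ℓ w} → ℓ ∈ rayLabels → neighboursT′ ℓ ≡ w ∷ [] → ¬ OnCycle ℓ
    leaf {ℓ} {w} ℓ∈ eq on =
      let (p , q , p∈ , q∈ , p≢q , _) = two-neighbours ℓ ℓ∈ on
      in no-two-distinct-in-[ w ] (subst (p ∈_) eq p∈) (subst (q ∈_) eq q∈) p≢q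

    next-to-one : ∀ ℓ → ℓ ∈ rayLabels → ∀ {w₁ w₂} → neighboursT′ ℓ ≡ w₁ ∷ w₂ ∷ [] → ¬ OnCycle w₂ → ¬ OnCycle ℓ
    next-to-one ℓ ℓ∈ eq off on =
      let (p , q , p∈ , q∈ , p≢q , onp , onq) = two-neighbours ℓ ℓ∈ on
      in off (two-distinct-in-pair⇒second {P = OnCycle} (subst (p ∈_) eq p∈) (subst (q ∈_) eq q∈) p≢q onp onq)

    not-a₂ : ¬ OnCycle ℓa₂
    not-a₂ = leaf {ℓa₂} (∈ᵇ⇒∈ refl) refl
    not-b₂ : ¬ OnCycle ℓb₂
    not-b₂ = leaf {ℓb₂} (∈ᵇ⇒∈ refl) refl
    not-b₃ : ¬ OnCycle ℓb₃
    not-b₃ = leaf {ℓb₃} (∈ᵇ⇒∈ refl) refl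
    not-a₁ : ¬ OnCycle ℓa₁
    not-a₁ = next-to-one ℓa₁ (∈ᵇ⇒∈ refl) refl not-a₂
    not-b₁ : ¬ OnCycle ℓb₁
    not-b₁ = next-to-one ℓb₁ (∈ᵇ⇒∈ refl) refl not-b₂
    not-a₃ : ¬ OnCycle ℓa₃
    not-a₃ = next-to-one ℓa₃ (∈ᵇ⇒∈ refl) refl not-b₃

    not-r : ¬ OnCycle ℓr
    not-r on =
      let (_ , _ , p∈ , q∈ , p≢q , onp , onq) = two-neighbours ℓr (here refl) on
      in [ not-a₁ , [ not-b₁ , not-a₃ ]′ ]′ (two-distinct-in-four⇒not-third {P = OnCycle} p∈ q∈ p≢q onp onq)

    not-on-cycle : ∀ ℓ → ℓ ∈ rayLabels → ¬ OnCycle ℓ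
    not-on-cycle _ (here refl)                                         = not-r
    not-on-cycle _ (there (here refl))                                 = not-a₁
    not-on-cycle _ (there (there (here refl)))                         = not-a₂
    not-on-cycle _ (there (there (there (here refl))))                 = not-a₃
    not-on-cycle _ (there (there (there (there (here refl)))))         = not-b₁
    not-on-cycle _ (there (there (there (there (there (here refl)))))) = not-b₂
    not-on-cycle _ (there (there (there (there (there (there (here refl))))))) = not-b₃

    outside : ∀ {z} → z ∈ (x ∷ (ys ∷ʳ y)) → inRays z ≡ false
    outside {z} z∈ = by-value (inRays z) refl
      where
      by-value : ∀ b → inRays z ≡ b → inRays z ≡ false
      by-value false z∉ = z∉
      by-value true  z∈ᵇ =
        let (ℓ , ℓ∈ , z≡) = ∈ᵇ-map-vt rayLabels {z} z∈ᵇ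
        in ⊥-elim (not-on-cycle ℓ ℓ∈ (subst (_∈ _) z≡ z∈))

  T′-acyclic : ¬ HasCycle T′
  T′-acyclic = acyclic-transfer T T′ inRays adj-off-rays (proj₂ tree) rays-off-cycles

  T′-tree : IsTree T′
  T′-tree = T′-connected , T′-acyclic

  c∉rays : inRays c ≡ false
  c∉rays = vt-∈ᵇ rayLabels ℓc

  module Outside = AgreeOutside T T′ inRays r c cut-T cut-T′ agree-off-rays (proj₁ tree) T′-connected r-c r-c′ c∉rays

  degree-off-rays : ∀ u → inRays u ≡ false → degree T u ≡ degree T′ u
  degree-off-rays u u∉ =
    trans (degree≡count T u) (trans (count-cong (λ v → adj-off-rays u v u∉)) (sym (degree≡count T′ u)))

  edgeWeight-off-rays : ∀ u v → inRays u ≡ false → inRays v ≡ false → edgeWeight T u v ≡ edgeWeight T′ u v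
  edgeWeight-off-rays u v u∉ v∉ =
    cong₂ _*_ (cong₂ _*_ (cong₂ _+_ (degree-off-rays u u∉) (degree-off-rays v v∉)) (Outside.nClose-outside u v u∉ v∉))
              (Outside.nClose-outside v u v∉ u∉)

  entry-off-rays : ∀ u v → inRays u ≡ false → (u ≡ c → v ≢ r) → entry T u v ≡ entry T′ u v
  entry-off-rays u v u∉ not-cr = begin
      (if adj T u v ∧ lt then edgeWeight T u v else 0)   ≡⟨ cong (λ b → if b ∧ lt then edgeWeight T u v else 0) (adj-off-rays u v u∉) ⟩
      (if adj T′ u v ∧ lt then edgeWeight T u v else 0)  ≡⟨ if-cong (adj T′ u v ∧ lt) same-weight ⟩
      (if adj T′ u v ∧ lt then edgeWeight T′ u v else 0) ∎
    where
    open ≡-Reasoning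
    lt : Bool
    lt = toℕ u <ᵇ toℕ v
    if-cong : ∀ b {x y : ℕ} → (b ≡ true → x ≡ y) → (if b then x else 0) ≡ (if b then y else 0)
    if-cong true  x≡y = x≡y refl
    if-cong false _   = refl
    v-off : Adj T u v → ∀ b → inRays v ≡ b → inRays v ≡ false
    v-off _ false v∉ = v∉
    v-off a true  v∈ = let (v≡r , u≡c) = cut-T v u (adj-sym T a) v∈ u∉ in ⊥-elim (not-cr u≡c v≡r)
    same-weight : adj T′ u v ∧ lt ≡ true → edgeWeight T u v ≡ edgeWeight T′ u v
    same-weight e = edgeWeight-off-rays u v u∉
      (v-off (trans (adj-off-rays u v u∉) (∧-conicalˡ (adj T′ u v) lt e)) (inRays v) refl)

  row-c : row T c + entry T′ c r ≡ row T′ c + entry T c r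
  row-c = begin
      row T c + entry T′ c r                                          ≡⟨ cong (row T c +_) (∑-single r (entry T′ c)) ⟨
      ∑ (entry T c) + ∑ (λ v → if v ≡ᵇ r then entry T′ c v else 0)   ≡⟨ ∑-swap (_≡ᵇ r) (entry T c) (entry T′ c) off-r ⟩
      ∑ (entry T′ c) + ∑ (λ v → if v ≡ᵇ r then entry T c v else 0)   ≡⟨ cong (row T′ c +_) (∑-single r (entry T c)) ⟩
      row T′ c + entry T c r                                          ∎
    where
    open ≡-Reasoning
    off-r : ∀ v → (v ≡ᵇ r) ≡ false → entry T c v ≡ entry T′ c v
    off-r v v≢r = entry-off-rays c v c∉rays (λ _ → ≡ᵇ-false⇒≢ v≢r)

  inConfig : Fin n → Bool
  inConfig u = u ∈ᵇ map vt (allFin 8)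

  rowsOfRays : SimpleGraph n → ℕ
  rowsOfRays G = sum (map (row G) (map vt rayLabels))

  rows-outside : wSz T + (row T′ c + rowsOfRays T′) ≡ wSz T′ + (row T c + rowsOfRays T)
  rows-outside = begin
      wSz T + (row T′ c + rowsOfRays T′)                         ≡⟨ cong₂ _+_ (wSz≡∑row T) (sym (on-config T′)) ⟩
      ∑ (row T) + ∑ (λ u → if inConfig u then row T′ u else 0)   ≡⟨ ∑-swap inConfig (row T) (row T′) off-config ⟩
      ∑ (row T′) + ∑ (λ u → if inConfig u then row T u else 0)   ≡⟨ cong₂ _+_ (sym (wSz≡∑row T′)) (on-config T) ⟩
      wSz T′ + (row T c + rowsOfRays T)                          ∎
    where
    open ≡-Reasoning
    on-config : ∀ G → ∑ (λ u → if inConfig u then row G u else 0) ≡ row G c + rowsOfRays G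
    on-config G = ∑-restrict-unique (map vt (allFin 8)) labelled-vertices-distinct (row G)
    off-config : ∀ u → inConfig u ≡ false → row T u ≡ row T′ u
    off-config u u∉ = sum-cong-≗ λ v →
      entry-off-rays u v (∨-conicalʳ (u ≡ᵇ c) _ u∉) (λ u≡c → ⊥-elim (≡ᵇ-false⇒≢ (∨-conicalˡ (u ≡ᵇ c) _ u∉) u≡c))

  m : ℕ
  m = n ∸ 8

  n≡8+m : n ≡ 8 + m
  n≡8+m = sym (m+[n∸m]≡n (length≤-unique (map vt (allFin 8)) labelled-vertices-distinct))

  entry-pair-branch : ∀ (G : SimpleGraph n) → Connected G → ∀ N → (∀ ℓ → ℓ ∈ rayLabels → NeighboursIn G ℓ (N ℓ)) →
    ∀ ls u v {du dv} → (all (_∈ᵇ rayLabels) ls ∧ IsBranch N ls u v) ≡ true → Unique ls → Adj G (vt u) (vt v) →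
    degree G (vt u) ≡ du → degree G (vt v) ≡ dv →
    entry G (vt u) (vt v) + entry G (vt v) (vt u) ≡ (du + dv) * length ls * (8 ∸ length ls + m)
  entry-pair-branch G conn N nbrs ls u v ok uniq a du dv =
    trans (entry-+-entry G a) (cong₂ _*_ (cong₂ _*_ (cong₂ _+_ du dv) (proj₁ sides)) rest)
    where
    in-rays : ∀ ℓ → ℓ ∈ ls → NeighboursIn G ℓ (N ℓ)
    in-rays ℓ ℓ∈ = nbrs ℓ (∈ᵇ⇒∈ (all-true⇒ (_∈ᵇ rayLabels) (∧-conicalˡ (all (_∈ᵇ rayLabels) ls) _ ok) ℓ∈))
    sides : nClose G (vt u) (vt v) ≡ length ls × length ls + nClose G (vt v) (vt u) ≡ n
    sides = nClose-branch G conn N ls u v in-rays (∧-conicalʳ (all (_∈ᵇ rayLabels) ls) _ ok) uniq a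
    len≤8 : length ls ≤ 8
    len≤8 = length≤-unique ls uniq
    rest : nClose G (vt v) (vt u) ≡ 8 ∸ length ls + m
    rest = +-cancelˡ-≡ (length ls) _ _ (begin
      length ls + nClose G (vt v) (vt u)  ≡⟨ proj₂ sides ⟩
      n                                   ≡⟨ n≡8+m ⟩
      8 + m                               ≡⟨ cong (_+ m) (m+[n∸m]≡n len≤8) ⟨
      length ls + (8 ∸ length ls) + m     ≡⟨ +-assoc (length ls) _ m ⟩
      length ls + (8 ∸ length ls + m)     ∎)
      where open ≡-Reasoning

  rays-T : rowsOfRays T + entry T c r ≡ weightsT m (degree T c)
  rays-T =
    trans (cong (_+ entry T c r) (sum-rows-by-labels T neighboursT rayLabels neighboursIn-T (unique-lists! neighboursT)))
    (trans (regroupT (e r a₁) (e r b₁) (e r c) (e a₁ r) (e a₁ a₂) (e a₂ a₁) (e a₂ a₃) (e a₃ a₂)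
                     (e b₁ r) (e b₁ b₂) (e b₂ b₁) (e b₂ b₃) (e b₃ b₂) (e c r))
    (+-cong₇ (pair (ℓa₁ ∷ ℓa₂ ∷ ℓa₃ ∷ []) ℓa₁ ℓr 2 3 refl (adj-sym T ρ.adj₀₁) ρ.deg₁ deg-r)
             (pair (ℓa₂ ∷ ℓa₃ ∷ []) ℓa₂ ℓa₁ 2 2 refl (adj-sym T ρ.adj₁₂) ρ.deg₂ ρ.deg₁)
             (pair (ℓa₃ ∷ []) ℓa₃ ℓa₂ 1 2 refl (adj-sym T ρ.adj₂₃) ρ.deg₃ ρ.deg₂)
             (pair (ℓb₁ ∷ ℓb₂ ∷ ℓb₃ ∷ []) ℓb₁ ℓr 2 3 refl (adj-sym T σ.adj₀₁) σ.deg₁ deg-r)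
             (pair (ℓb₂ ∷ ℓb₃ ∷ []) ℓb₂ ℓb₁ 2 2 refl (adj-sym T σ.adj₁₂) σ.deg₂ σ.deg₁)
             (pair (ℓb₃ ∷ []) ℓb₃ ℓb₂ 1 2 refl (adj-sym T σ.adj₂₃) σ.deg₃ σ.deg₂)
             (pair rayLabels ℓr ℓc 3 (degree T c) refl r-c deg-r refl)))
    where
    pair : ∀ ls u v du dv → (all (_∈ᵇ rayLabels) ls ∧ IsBranch neighboursT ls u v) ≡ true → {True (allPairs? (λ x y → ¬? (x ≟ y)) ls)} →
      Adj T (vt u) (vt v) → degree T (vt u) ≡ du → degree T (vt v) ≡ dv →
      entry T (vt u) (vt v) + entry T (vt v) (vt u) ≡ (du + dv) * length ls * (8 ∸ length ls + m)
    e : Fin n → Fin n → ℕ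
    e = entry T
    pair ls u v du dv ok {uniq} = entry-pair-branch T (proj₁ tree) neighboursT neighboursIn-T ls u v {du} {dv} ok (toWitness uniq)

  degree-T′ : ∀ ℓ → (ℓ ∈ᵇ rayLabels) ≡ true → degree T′ (vt ℓ) ≡ length (neighboursT′ ℓ)
  degree-T′ ℓ ℓ∈ᵇ = degree-by-labels T′ ℓ (neighboursT′ ℓ) (unique-lists! neighboursT′ ℓ) (neighboursIn-T′ ℓ ℓ∈)
    (edgesᵇ⇒All-Adj ℓ (neighboursT′ ℓ) (all-true⇒ (λ ℓ → all (edgeᵇ ℓ) (neighboursT′ ℓ)) listed ℓ∈))
    where
    ℓ∈ : ℓ ∈ rayLabels
    ℓ∈ = ∈ᵇ⇒∈ ℓ∈ᵇ
    listed : all (λ ℓ → all (edgeᵇ ℓ) (neighboursT′ ℓ)) rayLabels ≡ true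
    listed = refl

  rays-T′ : rowsOfRays T′ + entry T′ c r ≡ weightsT′ m (degree T c)
  rays-T′ =
    trans (cong (_+ entry T′ c r) (sum-rows-by-labels T′ neighboursT′ rayLabels neighboursIn-T′ (unique-lists! neighboursT′)))
    (trans (regroupT′ (e r a₁) (e r b₁) (e r c) (e r a₃) (e a₁ r) (e a₁ a₂) (e a₂ a₁) (e a₃ r) (e a₃ b₃)
                      (e b₁ r) (e b₁ b₂) (e b₂ b₁) (e b₃ a₃) (e c r))
    (+-cong₇ (pair (ℓa₁ ∷ ℓa₂ ∷ []) ℓa₁ ℓr 2 4 refl refl (degree-T′ ℓa₁ refl) (degree-T′ ℓr refl))
             (pair (ℓa₂ ∷ []) ℓa₂ ℓa₁ 1 2 refl refl (degree-T′ ℓa₂ refl) (degree-T′ ℓa₁ refl))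
             (pair (ℓb₁ ∷ ℓb₂ ∷ []) ℓb₁ ℓr 2 4 refl refl (degree-T′ ℓb₁ refl) (degree-T′ ℓr refl))
             (pair (ℓb₂ ∷ []) ℓb₂ ℓb₁ 1 2 refl refl (degree-T′ ℓb₂ refl) (degree-T′ ℓb₁ refl))
             (pair (ℓa₃ ∷ ℓb₃ ∷ []) ℓa₃ ℓr 2 4 refl refl (degree-T′ ℓa₃ refl) (degree-T′ ℓr refl))
             (pair (ℓb₃ ∷ []) ℓb₃ ℓa₃ 1 2 refl refl (degree-T′ ℓb₃ refl) (degree-T′ ℓa₃ refl))
             (pair rayLabels ℓr ℓc 4 (degree T c) refl refl (degree-T′ ℓr refl) (sym (degree-off-rays c c∉rays)))))
    where
    pair : ∀ ls u v du dv → (all (_∈ᵇ rayLabels) ls ∧ IsBranch neighboursT′ ls u v) ≡ true →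
      {True (allPairs? (λ x y → ¬? (x ≟ y)) ls)} → edgeᵇ u v ≡ true → degree T′ (vt u) ≡ du → degree T′ (vt v) ≡ dv →
      entry T′ (vt u) (vt v) + entry T′ (vt v) (vt u) ≡ (du + dv) * length ls * (8 ∸ length ls + m)
    e : Fin n → Fin n → ℕ
    e = entry T′
    pair ls u v du dv ok {uniq} uv = entry-pair-branch T′ T′-connected neighboursT′ neighboursIn-T′ ls u v {du} {dv} ok (toWitness uniq)
      (edgeᵇ⇒Adj u v uv)

  wSz-T≡wSz-T′+2 : wSz T ≡ wSz T′ + 2
  wSz-T≡wSz-T′+2 =
    difference-of-two {x = row T c} {row T′ c} {rowsOfRays T} {rowsOfRays T′} {entry T c r} {entry T′ c r}
      rows-outside row-c (begin
        rowsOfRays T + entry T c r        ≡⟨ rays-T ⟩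
        weightsT m (degree T c)           ≡⟨ weightsT≡weightsT′+2 m (degree T c) ⟩
        weightsT′ m (degree T c) + 2      ≡⟨ cong (_+ 2) rays-T′ ⟨
        rowsOfRays T′ + entry T′ c r + 2  ∎)
    where open ≡-Reasoning

proposition8 : (n : ℕ) → 1 ≤ n → (T : SimpleGraph n) → IsTree T →
    ((T′ : SimpleGraph n) → IsTree T′ → wSz T ≤ wSz T′) →
    (r : Fin n) → degree T r ≡ 3 →
    ¬ (Σ (Ray3 T r) λ ρ → Σ (Ray3 T r) λ σ → Ray3.r₁ ρ ≢ Ray3.r₁ σ)
proposition8 n _ T tree minimal r deg-r (ρ , σ , a₁≢b₁) =
  m+1+n≰m (wSz T′) (subst (_≤ wSz T′) wSz-T≡wSz-T′+2 (minimal T′ T′-tree))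
  where open TwoRaysAtDegreeThree tree deg-r ρ σ a₁≢b₁
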